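{- (i) Let $p$ be an odd prime and let $m,n\in\mathbb Z$ with $n\ge m+3$. Then for any complex numbers $a,b,c,d$, $$\det\left[a+b\left(\frac jp\right)+c\left(\frac kp\right)+d\left(\frac{jk}p\right)\right]_{m\le j,k\le n}=0.$$ (ii) Let $p>5$ be a prime with $p\equiv1\pmod4$. For any $\delta\in\{\pm1\}$, any $m\in\{0,1\}$ and any complex number $x$, $$\det\left[x+\left(\frac{j^2+k^2}p\right)+\delta\left(\frac{j^2-k^2}p\right)\right]_{m\le j,k\le (p-1)/2}=0.$$
   Context: $\left(\frac{\cdot}{p}\right)$ denotes the Legendre symbol modulo $p$, with $\left(\frac{a}{p}\right)=0$ when $p\mid a$. For a matrix indexed by $m\le j,k\le n$, $\det[a_{jk}]_{m\le j,k\le n}$ is its determinant. -}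

module Defs where

open import Data.Nat as ℕ using (ℕ; zero; suc; _≡ᵇ_)
open import Data.Integer as ℤ using (ℤ; +_; -[1+_]; _%ℕ_)
open import Data.Fin using (Fin; zero; suc; toℕ; punchIn)
open import Data.List using (upTo)
open import Data.Bool.ListAction using (any)
open import Data.Bool using (if_then_else_)
open import Algebra.Bundles using (CommutativeRing)

-- Legendre symbol (a / p) with values in {-1,0,1} ⊆ ℤ.
-- (a/p) = 0 if p ∣ a; 1 if a is a nonzero square mod p; -1 otherwise.
-- (For p = 0 we return 0; only used for odd primes p.)
legendre : ℕ → ℤ → ℤ
legendre zero    a = + 0
legendre (suc q) a =
  let p = suc q
      r = a %ℕ p
  in if r ≡ᵇ 0 then + 0
     else if any (λ x → ((x ℕ.* x) ℕ.% p) ≡ᵇ r) (upTo p) then + 1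
     else -[1+ 0 ]

module Det {c ℓ} (R : CommutativeRing c ℓ) where
  open CommutativeRing R using (Carrier; _+_; _*_; -_; 0#; 1#)

  Matrix : ℕ → Set c
  Matrix n = Fin n → Fin n → Carrier

  sumF : ∀ n → (Fin n → Carrier) → Carrier
  sumF zero    f = 0#
  sumF (suc n) f = f zero + sumF n (λ i → f (suc i))

  sgn : ℕ → Carrier
  sgn zero    = 1#
  sgn (suc k) = - sgn k

  ofℕ : ℕ → Carrier
  ofℕ zero    = 0#
  ofℕ (suc k) = 1# + ofℕ k

  ofℤ : ℤ → Carrier
  ofℤ (+ k)     = ofℕ k
  ofℤ -[1+ k ]  = - ofℕ (suc k)

  det : ∀ n → Matrix n → Carrier
  det zero    M = 1#
  det (suc n) M =
    sumF (suc n) (λ i → sgn (toℕ i) * M zero i * det n (λ r s → M (suc r) (punchIn i s)))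

  -- the matrix [f j k]_{m ≤ j,k ≤ n} for integers m ≤ n;
  -- its size is n - m + 1 and row/column i corresponds to j = m + i.
  intervalMatrix : (m n : ℤ) → (ℤ → ℤ → Carrier) → Matrix (suc ℤ.∣ n ℤ.- m ∣)
  intervalMatrix m n f i k = f (m ℤ.+ + toℕ i) (m ℤ.+ + toℕ k)

module Submission where

-- (i) The Legendre symbol χ takes only the values 0 and ±1, so among four consecutive column indices there
-- are k ≠ k′ with χ k = χ k′.  For odd p this forces χ (j k) = χ (j k′) for every j: either p divides both,
-- or k k′ is a square (for two non-residues by counting residues), so that k′ ≡ w² k.  Hence two columns agree.
-- (ii) For p ≡ 1 (mod 4), −1 is a square, which gives K₁, K₂ ∈ [1, (p − 1)/2] with K₁² ≡ −1 and K₂² ≡ −4.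
-- Replacing a column index k by K with K² ≡ −k² exchanges j² + k² and j² − k².  So for δ = 1 column K₁ equals
-- column 1, and for δ = −1 the columns satisfy C₁ + C_K₁ = 2x = C₂ + C_K₂.

open import Defs
open import Algebra.Bundles using (CommutativeMonoid; CommutativeRing)
open import Data.Bool using (Bool; T; true; false; if_then_else_)
open import Data.Bool.ListAction using (any)
open import Data.Empty using (⊥)
open import Data.Fin as Fin using (Fin; zero; suc; toℕ; punchIn; punchOut; inject₁)
import Data.Fin.Properties as Finₚ
open import Data.Fin.Permutation.Components using (transpose)
open import Data.Integer as ℤ using (ℤ; +_; -[1+_]; 0ℤ; 1ℤ; -1ℤ; _%ℕ_)
import Data.Integer.Properties as ℤₚ
open import Data.Integer.DivMod using (a≡a%ℕn+[a/ℕn]*n; n%ℕd<d)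
open import Data.Integer.Divisibility.Signed as ℤ∣ using (divides)
open import Data.Integer.Tactic.RingSolver using (solve-∀)
open import Data.List using (List; _∷_; _++_; upTo; applyUpTo; length; lookup; filter)
import Data.List.Properties as Listₚ
open import Data.List.Membership.Propositional using (_∈_)
open import Data.List.Membership.Propositional.Properties
  using (∈-upTo⁺; ∈-lookup; ∈-applyUpTo⁺; ∈-applyUpTo⁻; ∈-filter⁺; ∈-filter⁻)
open import Data.List.Relation.Unary.All as All using (All; _∷_)
import Data.List.Relation.Unary.All.Properties as Allₚ
open import Data.List.Relation.Unary.AllPairs using (AllPairs; _∷_)
import Data.List.Relation.Unary.AllPairs.Properties as AllPairsₚ
open import Data.List.Relation.Unary.Any as Any using (here; there; satisfied)
open import Data.List.Relation.Unary.Any.Properties using (any⁺; any⁻)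
open import Data.List.Relation.Unary.Unique.Propositional using (Unique)
import Data.List.Relation.Unary.Unique.Propositional.Properties as Uniqueₚ
open import Data.Maybe using (nothing)
open import Data.Nat as ℕ using (ℕ; zero; suc; _>_; _≡ᵇ_)
import Data.Nat.Divisibility as ℕ∣
import Data.Nat.DivMod as ℕ/
open import Data.Nat.Coprimality using (Coprime; prime⇒coprime; coprime⇒GCD≡1)
open import Data.Nat.GCD using (module Bézout; module GCD)
open import Data.Nat.Primality using (Prime; prime⇒nonZero; prime⇒nonTrivial; prime⇒irreducible; euclidsLemma)
import Data.Nat.Properties as ℕₚ
import Data.Nat.Tactic.RingSolver as ℕSolver
open import Data.Product using (∃-syntax; Σ-syntax; _×_; _,_; proj₁; proj₂)
open import Data.Sum as Sum using (_⊎_; inj₁; inj₂; [_,_]′)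
open import Data.Vec.Functional using (Vector; updateAt)
open import Data.Vec.Functional.Properties using (updateAt-updates; updateAt-minimal)
open import Function using (_∘_; _∘′_; const; _⇔_; mk⇔; Equivalence)
open import Relation.Binary using (IsEquivalence; Setoid)
open import Relation.Binary.Definitions using (DecidableEquality; tri<; tri≈; tri>)
open import Relation.Binary.PropositionalEquality as ≡ using (_≡_; _≢_; cong)
open import Relation.Nullary using (¬_; ¬?; Dec; yes; no; contradiction)
open import Relation.Nullary.Decidable using (dec-true; dec-false; decidable-stable)

module FiniteSums {a ℓ} (M : CommutativeMonoid a ℓ) where
  open CommutativeMonoid M renaming (_∙_ to _+_; ε to 0#; ∙-congˡ to +-congˡ)
  open import Algebra.Properties.CommutativeMonoid.Sum M
  open import Relation.Binary.Reasoning.Setoid setoid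

  private variable n : ℕ

  sum-zero : (f : Vector Carrier n) → (∀ i → f i ≈ 0#) → sum f ≈ 0#
  sum-zero {n} f f≈0 = trans (sum-cong-≋ f≈0) (sum-replicate-zero n)

  sum-single : (f : Vector Carrier (suc n)) (c : Fin (suc n)) →
               (∀ i → i ≢ c → f i ≈ 0#) → sum f ≈ f c
  sum-single f c f≈0 = begin
    sum f                         ≈⟨ sum-remove {i = c} f ⟩
    f c + sum (f ∘ punchIn c)     ≈⟨ +-congˡ (sum-zero _ (λ j → f≈0 _ (Finₚ.punchInᵢ≢i c j))) ⟩
    f c + 0#                      ≈⟨ identityʳ (f c) ⟩
    f c                           ∎

  sum-pair : (f : Vector Carrier (suc n)) {c d : Fin (suc n)} (c≢d : c ≢ d) →
             (∀ i → i ≢ c → i ≢ d → f i ≈ 0#) → sum f ≈ f c + f d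
  sum-pair {zero} f {zero} {zero} c≢d _ = contradiction ≡.refl c≢d
  sum-pair {suc n} f {c} {d} c≢d f≈0 = begin
    sum f                          ≈⟨ sum-remove {i = c} f ⟩
    f c + sum (f ∘ punchIn c)      ≈⟨ +-congˡ (sum-single (f ∘ punchIn c) (punchOut c≢d) vanish) ⟩
    f c + f (punchIn c (punchOut c≢d)) ≡⟨ cong (λ j → f c + f j) (Finₚ.punchIn-punchOut c≢d) ⟩
    f c + f d                      ∎
    where
    vanish : ∀ j → j ≢ punchOut c≢d → f (punchIn c j) ≈ 0#
    vanish j j≢ = f≈0 _ (Finₚ.punchInᵢ≢i c j)
      (λ eq → j≢ (Finₚ.punchIn-injective c _ _ (≡.trans eq (≡.sym (Finₚ.punchIn-punchOut c≢d)))))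

data Adjacent : ∀ {n} → Fin n → Fin n → Set where
  adjacent-zero : ∀ {n} → Adjacent {suc (suc n)} zero (suc zero)
  adjacent-suc  : ∀ {n} {c d : Fin n} → Adjacent c d → Adjacent (suc c) (suc d)

toℕ-adjacent : ∀ {n} {c d : Fin n} → Adjacent c d → toℕ d ≡ suc (toℕ c)
toℕ-adjacent adjacent-zero    = ≡.refl
toℕ-adjacent (adjacent-suc a) = cong suc (toℕ-adjacent a)

adjacent⇒≢ : ∀ {n} {c d : Fin n} → Adjacent c d → c ≢ d
adjacent⇒≢ a ≡.refl = ℕₚ.1+n≢n (≡.sym (toℕ-adjacent a))

adjacent-inject₁ : ∀ {n} (i : Fin (suc n)) → Adjacent (inject₁ i) (suc i)
adjacent-inject₁         zero    = adjacent-zero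
adjacent-inject₁ {suc _} (suc i) = adjacent-suc (adjacent-inject₁ i)

punchOut-adjacent : ∀ {n} {i c d : Fin (suc n)} (i≢c : i ≢ c) (i≢d : i ≢ d) →
                    Adjacent c d → Adjacent (punchOut i≢c) (punchOut i≢d)
punchOut-adjacent               {i = zero}        i≢c _   adjacent-zero    = contradiction ≡.refl i≢c
punchOut-adjacent               {i = suc zero}    _   i≢d adjacent-zero    = contradiction ≡.refl i≢d
punchOut-adjacent {suc (suc _)} {i = suc (suc _)} _   _   adjacent-zero    = adjacent-zero
punchOut-adjacent               {i = zero}        _   _   (adjacent-suc a) = a
punchOut-adjacent {suc _}       {i = suc _}       i≢c i≢d (adjacent-suc a) =
  adjacent-suc (punchOut-adjacent (i≢c ∘ cong suc) (i≢d ∘ cong suc) a)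

punchIn-adjacent : ∀ {n} {c d : Fin (suc n)} → Adjacent c d → ∀ s →
                   punchIn c s ≡ punchIn d s ⊎ (punchIn c s ≡ d × punchIn d s ≡ c)
punchIn-adjacent adjacent-zero    zero    = inj₂ (≡.refl , ≡.refl)
punchIn-adjacent adjacent-zero    (suc s) = inj₁ ≡.refl
punchIn-adjacent (adjacent-suc a) zero    = inj₁ ≡.refl
punchIn-adjacent (adjacent-suc a) (suc s) with punchIn-adjacent a s
... | inj₁ eq          = inj₁ (cong suc eq)
... | inj₂ (eq₁ , eq₂) = inj₂ (cong suc eq₁ , cong suc eq₂)

transpose-matchˡ : ∀ {n} (i j : Fin n) → transpose i j i ≡ j
transpose-matchˡ i j rewrite dec-true (i Fin.≟ i) ≡.refl = ≡.refl

transpose-matchʳ : ∀ {n} (i j : Fin n) → transpose i j j ≡ i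
transpose-matchʳ i j with j Fin.≟ i
... | yes ≡.refl = ≡.refl
... | no  _      rewrite dec-true (j Fin.≟ j) ≡.refl = ≡.refl

transpose-other : ∀ {n} {i j k : Fin n} → k ≢ i → k ≢ j → transpose i j k ≡ k
transpose-other {i = i} {j} {k} k≢i k≢j
  rewrite dec-false (k Fin.≟ i) k≢i | dec-false (k Fin.≟ j) k≢j = ≡.refl

module Determinant {a ℓ} (R : CommutativeRing a ℓ) where
  open CommutativeRing R hiding (zero)
  open Det R
  open import Algebra.Properties.Ring ring using (-‿distribˡ-*; +-inverseˡ-unique; -0#≈0#)
  open import Algebra.Properties.CommutativeMonoid.Sum +-commutativeMonoid
    using (sum; sum-cong-≋; ∑-distrib-+)
  open FiniteSums +-commutativeMonoid
  open import Algebra.Properties.CommutativeSemigroup +-commutativeSemigroup using (interchange)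
  open import Relation.Binary.Reasoning.Setoid setoid

  private variable n : ℕ

  minor : Fin (suc n) → Matrix (suc n) → Matrix n
  minor i M r s = M (suc r) (punchIn i s)

  laplaceTerm : Matrix (suc n) → Fin (suc n) → Carrier
  laplaceTerm M i = sgn (toℕ i) * M zero i * det _ (minor i M)

  sumF≡sum : ∀ n (f : Vector Carrier n) → sumF n f ≡ sum f
  sumF≡sum zero    f = ≡.refl
  sumF≡sum (suc n) f = cong (_+_ (f zero)) (sumF≡sum n (f ∘ suc))

  det-laplace : (M : Matrix (suc n)) → det (suc n) M ≈ sum (laplaceTerm M)
  det-laplace M = reflexive (sumF≡sum _ (laplaceTerm M))

  det-cong : {M N : Matrix n} → (∀ r s → M r s ≈ N r s) → det n M ≈ det n N
  det-cong {zero}  _   = refl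
  det-cong {suc n} {M} {N} M≈N = begin
    det _ M               ≈⟨ det-laplace M ⟩
    sum (laplaceTerm M)   ≈⟨ sum-cong-≋ term≈ ⟩
    sum (laplaceTerm N)   ≈⟨ det-laplace N ⟨
    det _ N               ∎
    where
    term≈ : ∀ i → laplaceTerm M i ≈ laplaceTerm N i
    term≈ i = *-cong (*-congˡ (M≈N zero i)) (det-cong (λ r s → M≈N (suc r) (punchIn i s)))

  minor-punchOut : ∀ {i c : Fin (suc n)} (i≢c : i ≢ c) (M : Matrix (suc n)) r →
                   minor i M r (punchOut i≢c) ≡ M (suc r) c
  minor-punchOut i≢c M r = cong (M (suc r)) (Finₚ.punchIn-punchOut i≢c)

  punchIn-≢ : ∀ {i c : Fin (suc n)} (i≢c : i ≢ c) {s} → s ≢ punchOut i≢c → punchIn i s ≢ c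
  punchIn-≢ {i = i} i≢c s≢ eq =
    s≢ (Finₚ.punchIn-injective i _ _ (≡.trans eq (≡.sym (Finₚ.punchIn-punchOut i≢c))))

  sgn-adjacent : ∀ {c d : Fin n} → Adjacent c d → ∀ x y → sgn (toℕ d) * x * y ≈ - (sgn (toℕ c) * x * y)
  sgn-adjacent {c = c} {d} adj x y = begin
    sgn (toℕ d) * x * y      ≡⟨ cong (λ k → sgn k * x * y) (toℕ-adjacent adj) ⟩
    - sgn (toℕ c) * x * y    ≈⟨ *-congʳ (-‿distribˡ-* _ _) ⟨
    - (sgn (toℕ c) * x) * y  ≈⟨ -‿distribˡ-* _ _ ⟨
    - (sgn (toℕ c) * x * y)  ∎

  EqualColumns : Fin n → Fin n → Matrix n → Set ℓ
  EqualColumns c d M = ∀ r → M r c ≈ M r d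

  record SwappedColumns (c d : Fin n) (M N : Matrix n) : Set ℓ where
    field
      at-c      : ∀ r → N r c ≈ M r d
      at-d      : ∀ r → N r d ≈ M r c
      elsewhere : ∀ r s → s ≢ c → s ≢ d → N r s ≈ M r s

  swappedColumns-sym : ∀ {c d : Fin n} {M N} → SwappedColumns c d M N → SwappedColumns c d N M
  swappedColumns-sym sw = record
    { at-c      = λ r → sym (at-d r)
    ; at-d      = λ r → sym (at-c r)
    ; elsewhere = λ r s s≢c s≢d → sym (elsewhere r s s≢c s≢d)
    }
    where open SwappedColumns sw

  equalColumns⇒swappedColumns : ∀ {c d : Fin n} {M} → EqualColumns c d M → SwappedColumns c d M M
  equalColumns⇒swappedColumns eq = record
    { at-c      = eq
    ; at-d      = λ r → sym (eq r)
    ; elsewhere = λ _ _ _ _ → refl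
    }

  minor-swappedColumns : ∀ {i c d : Fin (suc n)} (i≢c : i ≢ c) (i≢d : i ≢ d) {M N} →
                         SwappedColumns c d M N →
                         SwappedColumns (punchOut i≢c) (punchOut i≢d) (minor i M) (minor i N)
  minor-swappedColumns i≢c i≢d {M} {N} sw = record
    { at-c      = λ r → trans (reflexive (minor-punchOut i≢c N r))
                          (trans (at-c (suc r)) (reflexive (≡.sym (minor-punchOut i≢d M r))))
    ; at-d      = λ r → trans (reflexive (minor-punchOut i≢d N r))
                          (trans (at-d (suc r)) (reflexive (≡.sym (minor-punchOut i≢c M r))))
    ; elsewhere = λ r s s≢c s≢d → elsewhere (suc r) _ (punchIn-≢ i≢c s≢c) (punchIn-≢ i≢d s≢d)
    }
    where open SwappedColumns sw

  minor-swapped-adjacent : ∀ {c d : Fin (suc n)} {M N} → Adjacent c d → SwappedColumns c d M N →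
                           ∀ r s → minor c N r s ≈ minor d M r s
  minor-swapped-adjacent {c = c} {d} {M} {N} adj sw r s with punchIn-adjacent adj s
  ... | inj₁ same          = trans (elsewhere (suc r) _ (Finₚ.punchInᵢ≢i c s)
                                      (λ c↦d → Finₚ.punchInᵢ≢i d s (≡.trans (≡.sym same) c↦d)))
                                   (reflexive (cong (M (suc r)) same))
    where open SwappedColumns sw
  ... | inj₂ (c↦d , d↦c) = trans (reflexive (cong (N (suc r)) c↦d))
                                   (trans (at-d (suc r)) (reflexive (cong (M (suc r)) (≡.sym d↦c))))
    where open SwappedColumns sw

  laplaceTerm-swapped-adjacent : ∀ {c d : Fin (suc n)} {M N} → Adjacent c d → SwappedColumns c d M N →
                                 laplaceTerm N c + laplaceTerm M d ≈ 0#
  laplaceTerm-swapped-adjacent {c = c} {d} {M} {N} adj sw = begin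
    sgn (toℕ c) * N zero c * det _ (minor c N) + sgn (toℕ d) * M zero d * det _ (minor d M)
      ≈⟨ +-cong (*-cong (*-congˡ (SwappedColumns.at-c sw zero)) (det-cong (minor-swapped-adjacent adj sw)))
                (sgn-adjacent adj _ _) ⟩
    sgn (toℕ c) * M zero d * det _ (minor d M) + - (sgn (toℕ c) * M zero d * det _ (minor d M))
      ≈⟨ -‿inverseʳ _ ⟩
    0# ∎

  det-adjacent-equal-columns : ∀ {c d : Fin n} {M : Matrix n} →
                               Adjacent c d → EqualColumns c d M → det n M ≈ 0#
  det-adjacent-equal-columns {suc n} {c} {d} {M} adj eq = begin
    det _ M                             ≈⟨ det-laplace M ⟩
    sum (laplaceTerm M)                 ≈⟨ sum-pair _ (adjacent⇒≢ adj) vanish ⟩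
    laplaceTerm M c + laplaceTerm M d   ≈⟨ laplaceTerm-swapped-adjacent adj (equalColumns⇒swappedColumns eq) ⟩
    0#                                  ∎
    where
    vanish : ∀ i → i ≢ c → i ≢ d → laplaceTerm M i ≈ 0#
    vanish i i≢c i≢d = trans (*-congˡ (det-adjacent-equal-columns (punchOut-adjacent i≢c i≢d adj)
      (SwappedColumns.at-c (minor-swappedColumns i≢c i≢d (equalColumns⇒swappedColumns eq))))) (zeroʳ _)

  det-swap-adjacent : ∀ {c d : Fin n} {M N : Matrix n} →
                      Adjacent c d → SwappedColumns c d M N → det n N ≈ - det n M
  det-swap-adjacent adj sw = +-inverseˡ-unique _ _ (det-swap-adjacent-+ adj sw)
    where
    det-swap-adjacent-+ : ∀ {n} {c d : Fin n} {M N : Matrix n} →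
                          Adjacent c d → SwappedColumns c d M N → det n N + det n M ≈ 0#
    det-swap-adjacent-+ {suc n} {c} {d} {M} {N} adj sw = begin
      det _ N + det _ M                             ≈⟨ +-cong (det-laplace N) (det-laplace M) ⟩
      sum (laplaceTerm N) + sum (laplaceTerm M)     ≈⟨ ∑-distrib-+ (laplaceTerm N) (laplaceTerm M) ⟨
      sum (λ i → laplaceTerm N i + laplaceTerm M i) ≈⟨ sum-pair _ (adjacent⇒≢ adj) vanish ⟩
      (Nc + Mc) + (Nd + Md)                         ≈⟨ +-congˡ (+-comm Nd Md) ⟩
      (Nc + Mc) + (Md + Nd)                         ≈⟨ interchange Nc Mc Md Nd ⟩
      (Nc + Md) + (Mc + Nd)                         ≈⟨ +-cong (laplaceTerm-swapped-adjacent adj sw)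
                                                              (laplaceTerm-swapped-adjacent adj (swappedColumns-sym sw)) ⟩
      0# + 0#                                       ≈⟨ +-identityʳ 0# ⟩
      0#                                            ∎
      where
      Nc = laplaceTerm N c
      Nd = laplaceTerm N d
      Mc = laplaceTerm M c
      Md = laplaceTerm M d
      vanish : ∀ i → i ≢ c → i ≢ d → laplaceTerm N i + laplaceTerm M i ≈ 0#
      vanish i i≢c i≢d = begin
        sgn (toℕ i) * N zero i * det _ (minor i N) + sgn (toℕ i) * M zero i * det _ (minor i M)
          ≈⟨ +-congʳ (*-congʳ (*-congˡ (SwappedColumns.elsewhere sw zero i i≢c i≢d))) ⟩
        sgn (toℕ i) * M zero i * det _ (minor i N) + sgn (toℕ i) * M zero i * det _ (minor i M)
          ≈⟨ distribˡ _ _ _ ⟨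
        sgn (toℕ i) * M zero i * (det _ (minor i N) + det _ (minor i M))
          ≈⟨ *-congˡ (det-swap-adjacent-+ (punchOut-adjacent i≢c i≢d adj) (minor-swappedColumns i≢c i≢d sw)) ⟩
        sgn (toℕ i) * M zero i * 0#
          ≈⟨ zeroʳ _ ⟩
        0# ∎

  swapColumns : Fin n → Fin n → Matrix n → Matrix n
  swapColumns c d M r s = M r (transpose c d s)

  swappedColumns-swapColumns : ∀ (c d : Fin n) M → SwappedColumns c d (swapColumns c d M) M
  swappedColumns-swapColumns c d M = record
    { at-c      = λ r → reflexive (cong (M r) (≡.sym (transpose-matchʳ c d)))
    ; at-d      = λ r → reflexive (cong (M r) (≡.sym (transpose-matchˡ c d)))
    ; elsewhere = λ r s s≢c s≢d → reflexive (cong (M r) (≡.sym (transpose-other s≢c s≢d)))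
    }

  det-equal-columns-< : ∀ k {c d : Fin n} {M : Matrix n} →
                        toℕ d ≡ k → c Fin.< d → EqualColumns c d M → det n M ≈ 0#
  det-equal-columns-< {suc zero}    _       {d = suc ()}
  det-equal-columns-< {suc (suc _)} zero    {d = suc d} ()
  det-equal-columns-< {suc (suc _)} (suc k) {c} {suc d} {M} d≡1+k c<d eq with c Fin.≟ inject₁ d
  ... | yes ≡.refl = det-adjacent-equal-columns {M = M} (adjacent-inject₁ d) eq
  ... | no  c≢e    = begin
    det _ M       ≈⟨ det-swap-adjacent {M = N} (adjacent-inject₁ d) (swappedColumns-swapColumns _ _ M) ⟩
    - det _ N     ≈⟨ -‿cong (det-equal-columns-< k {M = N} e≡k c<e eqN) ⟩
    - 0#          ≈⟨ -0#≈0# ⟩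
    0#            ∎
    where
    -- Swapping column d with its left neighbour brings the two equal columns closer together.
    N = swapColumns (inject₁ d) (suc d) M
    e≡k : toℕ (inject₁ d) ≡ k
    e≡k = ≡.trans (Finₚ.toℕ-inject₁ d) (ℕₚ.suc-injective d≡1+k)
    c<e : c Fin.< inject₁ d
    c<e = Finₚ.≤∧≢⇒< (Finₚ.<⇒≤pred c<d) c≢e
    eqN : EqualColumns c (inject₁ d) N
    eqN r = begin
      N r c       ≡⟨ cong (M r) (transpose-other c≢e (Finₚ.<⇒≢ c<d)) ⟩
      M r c       ≈⟨ eq r ⟩
      M r (suc d) ≡⟨ cong (M r) (transpose-matchˡ (inject₁ d) (suc d)) ⟨
      N r (inject₁ d) ∎

  det-equal-columns : ∀ (M : Matrix n) {c d} → c ≢ d → EqualColumns c d M → det n M ≈ 0#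
  det-equal-columns M {c} {d} c≢d eq with Finₚ.<-cmp c d
  ... | tri< c<d _ _ = det-equal-columns-< _ ≡.refl c<d eq
  ... | tri≈ _ c≡d _ = contradiction c≡d c≢d
  ... | tri> _ _ d<c = det-equal-columns-< _ ≡.refl d<c (sym ∘ eq)

  AgreeOffColumn : Fin n → Matrix n → Matrix n → Set ℓ
  AgreeOffColumn c M N = ∀ r s → s ≢ c → M r s ≈ N r s

  det-additive-column : ∀ (c : Fin n) {A B C : Matrix n} →
                        AgreeOffColumn c A B → AgreeOffColumn c A C → (∀ r → A r c ≈ B r c + C r c) →
                        det n A ≈ det n B + det n C
  det-additive-column {suc n} c {A} {B} {C} A~B A~C A≈B+C = begin
    det _ A                                           ≈⟨ det-laplace A ⟩
    sum (laplaceTerm A)                               ≈⟨ sum-cong-≋ term-additive ⟩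
    sum (λ i → laplaceTerm B i + laplaceTerm C i)     ≈⟨ ∑-distrib-+ (laplaceTerm B) (laplaceTerm C) ⟩
    sum (laplaceTerm B) + sum (laplaceTerm C)         ≈⟨ +-cong (det-laplace B) (det-laplace C) ⟨
    det _ B + det _ C                                 ∎
    where
    term-additive : ∀ i → laplaceTerm A i ≈ laplaceTerm B i + laplaceTerm C i
    term-additive i with i Fin.≟ c
    ... | yes ≡.refl = begin
      sgn (toℕ i) * A zero i * det _ (minor i A)
        ≈⟨ *-congʳ (*-congˡ (A≈B+C zero)) ⟩
      sgn (toℕ i) * (B zero i + C zero i) * det _ (minor i A)
        ≈⟨ *-congʳ (distribˡ _ _ _) ⟩
      (sgn (toℕ i) * B zero i + sgn (toℕ i) * C zero i) * det _ (minor i A)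
        ≈⟨ distribʳ _ _ _ ⟩
      sgn (toℕ i) * B zero i * det _ (minor i A) + sgn (toℕ i) * C zero i * det _ (minor i A)
        ≈⟨ +-cong (*-congˡ (det-cong (λ r s → A~B (suc r) _ (Finₚ.punchInᵢ≢i i s))))
                  (*-congˡ (det-cong (λ r s → A~C (suc r) _ (Finₚ.punchInᵢ≢i i s)))) ⟩
      laplaceTerm B i + laplaceTerm C i ∎
    ... | no i≢c = begin
      sgn (toℕ i) * A zero i * det _ (minor i A)
        ≈⟨ *-congˡ (det-additive-column (punchOut i≢c)
                      (λ r s s≢ → A~B (suc r) _ (punchIn-≢ i≢c s≢))
                      (λ r s s≢ → A~C (suc r) _ (punchIn-≢ i≢c s≢))
                      (λ r → begin
                        minor i A r (punchOut i≢c)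
                          ≡⟨ minor-punchOut i≢c A r ⟩
                        A (suc r) c
                          ≈⟨ A≈B+C (suc r) ⟩
                        B (suc r) c + C (suc r) c
                          ≡⟨ ≡.cong₂ _+_ (minor-punchOut i≢c B r) (minor-punchOut i≢c C r) ⟨
                        minor i B r (punchOut i≢c) + minor i C r (punchOut i≢c) ∎)) ⟩
      sgn (toℕ i) * A zero i * (det _ (minor i B) + det _ (minor i C))
        ≈⟨ distribˡ _ _ _ ⟩
      sgn (toℕ i) * A zero i * det _ (minor i B) + sgn (toℕ i) * A zero i * det _ (minor i C)
        ≈⟨ +-cong (*-congʳ (*-congˡ (A~B zero i i≢c))) (*-congʳ (*-congˡ (A~C zero i i≢c))) ⟩
      laplaceTerm B i + laplaceTerm C i ∎

  replaceColumn : Fin n → Vector Carrier n → Matrix n → Matrix n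
  replaceColumn c v M r = updateAt (M r) c (const (v r))

  replaceColumn-at : ∀ (c : Fin n) v M r → replaceColumn c v M r c ≡ v r
  replaceColumn-at c v M r = updateAt-updates c (M r)

  replaceColumn-off : ∀ (c : Fin n) v M → AgreeOffColumn c (replaceColumn c v M) M
  replaceColumn-off c v M r s s≢c = reflexive (updateAt-minimal s c (M r) s≢c)

  replaceColumn-agree : ∀ (c : Fin n) v w M → AgreeOffColumn c (replaceColumn c v M) (replaceColumn c w M)
  replaceColumn-agree c v w M r s s≢c =
    trans (replaceColumn-off c v M r s s≢c) (sym (replaceColumn-off c w M r s s≢c))

  det-replaceColumn-copy : ∀ {c t : Fin n} (M : Matrix n) → c ≢ t → det n (replaceColumn c (λ r → M r t) M) ≈ 0#
  det-replaceColumn-copy {c = c} {t} M c≢t = det-equal-columns M′ c≢t (λ r → begin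
    M′ r c ≡⟨ replaceColumn-at c (λ r → M r t) M r ⟩
    M r t  ≡⟨ updateAt-minimal t c (M r) (c≢t ∘ ≡.sym) ⟨
    M′ r t ∎)
    where M′ = replaceColumn c (λ r → M r t) M

  det-dependent-columns : ∀ {c s e f : Fin n} (M : Matrix n) → c ≢ s → c ≢ e → c ≢ f →
                          (∀ r → M r c + M r s ≈ M r e + M r f) → det n M ≈ 0#
  det-dependent-columns {c = c} {s} {e} {f} M c≢s c≢e c≢f dependent = begin
    det _ M                             ≈⟨ +-identityʳ _ ⟨
    det _ M + 0#                        ≈⟨ +-congˡ (det-replaceColumn-copy M c≢s) ⟨
    det _ M + det _ (copy s)            ≈⟨ det-additive-column c (replaceColumn-off c sum-cs M)
                                             (replaceColumn-agree c sum-cs (col s) M) split-cs ⟨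
    det _ (replaceColumn c sum-cs M)    ≈⟨ det-additive-column c (replaceColumn-agree c sum-cs (col e) M)
                                             (replaceColumn-agree c sum-cs (col f) M) split-ef ⟩
    det _ (copy e) + det _ (copy f)     ≈⟨ +-cong (det-replaceColumn-copy M c≢e) (det-replaceColumn-copy M c≢f) ⟩
    0# + 0#                             ≈⟨ +-identityʳ 0# ⟩
    0#                                  ∎
    where
    col : Fin _ → Vector Carrier _
    col t r = M r t
    copy : Fin _ → Matrix _
    copy t = replaceColumn c (col t) M
    sum-cs : Vector Carrier _
    sum-cs r = M r c + M r s
    at-c : ∀ v r → replaceColumn c v M r c ≈ v r
    at-c v r = reflexive (replaceColumn-at c v M r)
    split-cs : ∀ r → replaceColumn c sum-cs M r c ≈ M r c + copy s r c
    split-cs r = trans (at-c sum-cs r) (+-congˡ (sym (at-c (col s) r)))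
    split-ef : ∀ r → replaceColumn c sum-cs M r c ≈ copy e r c + copy f r c
    split-ef r = trans (at-c sum-cs r) (trans (dependent r) (sym (+-cong (at-c (col e) r) (at-c (col f) r))))

module FreeInvolution {a} {A : Set a} (_≟_ : DecidableEquality A) (σ : A → A) where

  record FreeInvolutionOn (xs : List A) : Set a where
    field
      closed           : ∀ {x} → x ∈ xs → σ x ∈ xs
      involutive       : ∀ {x} → x ∈ xs → σ (σ x) ≡ x
      fixed-point-free : ∀ {x} → x ∈ xs → σ x ≢ x

  private
    without : A → List A → List A
    without y = filter (λ x → ¬? (x ≟ y))

    ∈-without : ∀ {x y ys} → x ∈ ys → x ≢ y → x ∈ without y ys
    ∈-without = ∈-filter⁺ (λ x → ¬? (x ≟ _))

    ∈-without⁻ : ∀ {x y} ys → x ∈ without y ys → x ∈ ys × x ≢ y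
    ∈-without⁻ ys = ∈-filter⁻ (λ x → ¬? (x ≟ _)) {xs = ys}

    length-without : ∀ {y ys} → Unique ys → y ∈ ys → length ys ≡ suc (length (without y ys))
    length-without {y} {_ ∷ ws} (y∉ws ∷ _) (here ≡.refl) =
      cong (suc ∘′ length) (≡.sym (≡.trans (Listₚ.filter-reject (λ x → ¬? (x ≟ y)) (λ ¬y≢y → ¬y≢y ≡.refl))
        (Listₚ.filter-all (λ x → ¬? (x ≟ y)) (All.map (λ y≢x → y≢x ∘′ ≡.sym) y∉ws))))
    length-without {y} {w ∷ ws} (w∉ws ∷ u) (there y∈ws) =
      ≡.trans (cong suc (length-without u y∈ws))
              (cong (suc ∘′ length) (≡.sym (Listₚ.filter-accept (λ x → ¬? (x ≟ y)) (All.lookup w∉ws y∈ws))))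

    remove-pair : ∀ {x ys} → Unique (x ∷ ys) → FreeInvolutionOn (x ∷ ys) → FreeInvolutionOn (without (σ x) ys)
    remove-pair {x} {ys} (x∉ys ∷ _) inv = record
      { closed           = closed′
      ; involutive       = λ z∈ → involutive (there (proj₁ (∈-without⁻ ys z∈)))
      ; fixed-point-free = λ z∈ → fixed-point-free (there (proj₁ (∈-without⁻ ys z∈)))
      }
      where
      open FreeInvolutionOn inv
      closed′ : ∀ {z} → z ∈ without (σ x) ys → σ z ∈ without (σ x) ys
      closed′ {z} z∈zs with z∈ys , z≢σx ← ∈-without⁻ ys z∈zs | closed (there z∈ys)
      ... | here σz≡x    = contradiction (≡.trans (≡.sym (involutive (there z∈ys))) (cong σ σz≡x)) z≢σx
      ... | there σz∈ys = ∈-without σz∈ys (λ σz≡σx → All.lookup x∉ys z∈ys (≡.sym (begin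
        z           ≡⟨ involutive (there z∈ys) ⟨
        σ (σ z)     ≡⟨ cong σ σz≡σx ⟩
        σ (σ x)     ≡⟨ involutive (here ≡.refl) ⟩
        x           ∎)))
        where open ≡.≡-Reasoning

    length-even-of : ∀ n {xs} → length xs ≡ n → Unique xs → FreeInvolutionOn xs → ∃[ k ] n ≡ 2 ℕ.* k
    length-even-of zero                _   _ _   = 0 , ≡.refl
    length-even-of (suc n) {x ∷ ys} len u@(_ ∷ u′) inv with FreeInvolutionOn.closed inv (here ≡.refl)
    ... | here σx≡x   = contradiction σx≡x (FreeInvolutionOn.fixed-point-free inv (here ≡.refl))
    ... | there σx∈ys with n | ≡.trans (≡.sym (ℕₚ.suc-injective len)) (length-without u′ σx∈ys)
    ...   | suc m | 1+m≡ =
      let k , m≡2k = length-even-of m (≡.sym (ℕₚ.suc-injective 1+m≡)) (Uniqueₚ.filter⁺ _ u′) (remove-pair u inv)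
      in suc k , ≡.trans (cong (suc ∘′ suc) m≡2k) (≡.sym (ℕₚ.*-suc 2 k))

  length-even : ∀ {xs} → Unique xs → FreeInvolutionOn xs → ∃[ k ] length xs ≡ 2 ℕ.* k
  length-even = length-even-of _ ≡.refl

residueSymbol : (p : ℕ) .{{_ : ℕ.NonZero p}} → ℕ → ℤ
residueSymbol p r =
  if r ≡ᵇ 0 then 0ℤ
  else if any (λ x → (x ℕ.* x) ℕ.% p ≡ᵇ r) (upTo p) then 1ℤ
  else -1ℤ

legendre-residueSymbol : ∀ p .{{_ : ℕ.NonZero p}} a → legendre p a ≡ residueSymbol p (a %ℕ p)
legendre-residueSymbol (suc _) a = ≡.refl

ℕ-identity⇒ℤ : ∀ a b c d e → a ℕ.+ b ℕ.* c ≡ d ℕ.* e → + a ℤ.+ + b ℤ.* + c ≡ + d ℤ.* + e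
ℕ-identity⇒ℤ a b c d e eq = begin
  + a ℤ.+ + b ℤ.* + c   ≡⟨ cong (ℤ._+_ (+ a)) (ℤₚ.pos-* b c) ⟨
  + (a ℕ.+ b ℕ.* c)     ≡⟨ cong +_ eq ⟩
  + (d ℕ.* e)           ≡⟨ ℤₚ.pos-* d e ⟩
  + d ℤ.* + e           ∎
  where open ≡.≡-Reasoning

allPairs-lookup : ∀ {a r} {A : Set a} {R : A → A → Set r} {xs : List A} → AllPairs R xs →
                  ∀ {i j} → i Fin.< j → R (lookup xs i) (lookup xs j)
allPairs-lookup (Rx ∷ _)   {zero}  {suc j} _   = All.lookup Rx (∈-lookup j)
allPairs-lookup (_ ∷ Rxs)  {suc i} {suc j} i<j = allPairs-lookup Rxs (ℕₚ.≤-pred i<j)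

module Residues (p : ℕ) (p-prime : Prime p) where

  instance
    p≢0 : ℕ.NonZero p
    p≢0 = prime⇒nonZero p-prime

  infix 4 _≡ₚ_ _≢ₚ_

  -- A record rather than a synonym for the divisibility, so that a and b can be inferred from a proof.
  record _≡ₚ_ (a b : ℤ) : Set where
    constructor congruent
    field p∣a-b : + p ℤ∣.∣ a ℤ.- b

  _≢ₚ_ : ℤ → ℤ → Set
  a ≢ₚ b = ¬ a ≡ₚ b

  private
    ∣-resp-≡ : ∀ {x y} → x ≡ y → + p ℤ∣.∣ y → + p ℤ∣.∣ x
    ∣-resp-≡ ≡.refl d = d

  ≡ₚ-reflexive : ∀ {a b} → a ≡ b → a ≡ₚ b
  ≡ₚ-reflexive {a} ≡.refl = congruent (divides 0ℤ (ℤₚ.+-inverseʳ a))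

  ≡ₚ-sym : ∀ {a b} → a ≡ₚ b → b ≡ₚ a
  ≡ₚ-sym {a} {b} (congruent d) = congruent (∣-resp-≡ (identity a b) (ℤ∣.∣m⇒∣-m d))
    where identity : ∀ a b → b ℤ.- a ≡ ℤ.- (a ℤ.- b)
          identity = solve-∀

  ≡ₚ-trans : ∀ {a b c} → a ≡ₚ b → b ≡ₚ c → a ≡ₚ c
  ≡ₚ-trans {a} {b} {c} (congruent d) (congruent e) = congruent (∣-resp-≡ (identity a b c) (ℤ∣.∣m∣n⇒∣m+n d e))
    where identity : ∀ a b c → a ℤ.- c ≡ (a ℤ.- b) ℤ.+ (b ℤ.- c)
          identity = solve-∀

  ≡ₚ-isEquivalence : IsEquivalence _≡ₚ_
  ≡ₚ-isEquivalence = record { refl = ≡ₚ-reflexive ≡.refl ; sym = ≡ₚ-sym ; trans = ≡ₚ-trans }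

  ≡ₚ-setoid : Setoid _ _
  ≡ₚ-setoid = record { isEquivalence = ≡ₚ-isEquivalence }

  open IsEquivalence ≡ₚ-isEquivalence public using () renaming (refl to ≡ₚ-refl)
  open import Relation.Binary.Reasoning.Setoid ≡ₚ-setoid

  +-congₚ : ∀ {a b c d} → a ≡ₚ b → c ≡ₚ d → a ℤ.+ c ≡ₚ b ℤ.+ d
  +-congₚ {a} {b} {c} {d} (congruent e) (congruent f) = congruent (∣-resp-≡ (identity a b c d) (ℤ∣.∣m∣n⇒∣m+n e f))
    where identity : ∀ a b c d → (a ℤ.+ c) ℤ.- (b ℤ.+ d) ≡ (a ℤ.- b) ℤ.+ (c ℤ.- d)
          identity = solve-∀

  *-congₚ : ∀ {a b c d} → a ≡ₚ b → c ≡ₚ d → a ℤ.* c ≡ₚ b ℤ.* d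
  *-congₚ {a} {b} {c} {d} (congruent e) (congruent f) =
    congruent (∣-resp-≡ (identity a b c d) (ℤ∣.∣m∣n⇒∣m+n (ℤ∣.∣m⇒∣m*n c e) (ℤ∣.∣n⇒∣m*n b f)))
    where identity : ∀ a b c d → a ℤ.* c ℤ.- b ℤ.* d ≡ (a ℤ.- b) ℤ.* c ℤ.+ b ℤ.* (c ℤ.- d)
          identity = solve-∀

  -‿congₚ : ∀ {a b} → a ≡ₚ b → ℤ.- a ≡ₚ ℤ.- b
  -‿congₚ {a} {b} (congruent e) = congruent (∣-resp-≡ (identity a b) (ℤ∣.∣m⇒∣-m e))
    where identity : ∀ a b → ℤ.- a ℤ.- ℤ.- b ≡ ℤ.- (a ℤ.- b)
          identity = solve-∀

  ≡ₚ0⇒∣ : ∀ {a} → a ≡ₚ 0ℤ → + p ℤ∣.∣ a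
  ≡ₚ0⇒∣ {a} (congruent d) = ∣-resp-≡ (≡.sym (ℤₚ.+-identityʳ a)) d

  ∣⇒≡ₚ0 : ∀ {a} → + p ℤ∣.∣ a → a ≡ₚ 0ℤ
  ∣⇒≡ₚ0 {a} d = congruent (∣-resp-≡ (ℤₚ.+-identityʳ a) d)

  multiple≡ₚ0 : ∀ k → k ℤ.* + p ≡ₚ 0ℤ
  multiple≡ₚ0 k = ∣⇒≡ₚ0 (divides k ≡.refl)

  p≡ₚ0 : + p ≡ₚ 0ℤ
  p≡ₚ0 = ∣⇒≡ₚ0 ℤ∣.∣-refl

  residue-≡ₚ : ∀ a → + (a %ℕ p) ≡ₚ a
  residue-≡ₚ a = begin
    + (a %ℕ p)                              ≡⟨ ℤₚ.+-identityʳ _ ⟨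
    + (a %ℕ p) ℤ.+ 0ℤ                       ≈⟨ +-congₚ (≡ₚ-refl {+ (a %ℕ p)}) (≡ₚ-sym (multiple≡ₚ0 (a ℤ./ℕ p))) ⟩
    + (a %ℕ p) ℤ.+ (a ℤ./ℕ p) ℤ.* + p       ≡⟨ a≡a%ℕn+[a/ℕn]*n a p ⟨
    a                                       ∎

  private
    divisible-below-p : ∀ {m} → m ℕ.< p → p ℕ∣.∣ m → m ≡ 0
    divisible-below-p {zero}  _   _   = ≡.refl
    divisible-below-p {suc m} m<p p∣m = contradiction m<p (ℕₚ.≤⇒≯ (ℕ∣.∣⇒≤ p∣m))

    ≡ₚ-≤⇒≡ : ∀ {r s} → r ℕ.≤ s → s ℕ.< p → + r ≡ₚ + s → r ≡ s
    ≡ₚ-≤⇒≡ {r} {s} r≤s s<p (congruent d) =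
      ℕₚ.≤-antisym r≤s (ℕₚ.m∸n≡0⇒m≤n (divisible-below-p (ℕₚ.≤-<-trans (ℕₚ.m∸n≤m s r) s<p) p∣s∸r))
      where
      distance : ℤ.∣ + r ℤ.- + s ∣ ≡ s ℕ.∸ r
      distance = ℤₚ.+-injective (≡.trans (ℤₚ.∣-∣-≤ (ℤ.+≤+ r≤s))
                                         (≡.trans (ℤₚ.m-n≡m⊖n s r) (ℤₚ.⊖-≥ r≤s)))
      p∣s∸r : p ℕ∣.∣ s ℕ.∸ r
      p∣s∸r = ≡.subst (p ℕ∣.∣_) distance (ℤ∣.∣⇒∣ᵤ d)

  ≡ₚ-below-p⇒≡ : ∀ {r s} → r ℕ.< p → s ℕ.< p → + r ≡ₚ + s → r ≡ s
  ≡ₚ-below-p⇒≡ {r} {s} r<p s<p r≡s with ℕₚ.≤-total r s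
  ... | inj₁ r≤s = ≡ₚ-≤⇒≡ r≤s s<p r≡s
  ... | inj₂ s≤r = ≡.sym (≡ₚ-≤⇒≡ s≤r r<p (≡ₚ-sym r≡s))

  ≡ₚ⇒%ℕ≡ : ∀ {a b} → a ≡ₚ b → a %ℕ p ≡ b %ℕ p
  ≡ₚ⇒%ℕ≡ {a} {b} a≡b = ≡ₚ-below-p⇒≡ (n%ℕd<d a p) (n%ℕd<d b p) (begin
    + (a %ℕ p)  ≈⟨ residue-≡ₚ a ⟩
    a           ≈⟨ a≡b ⟩
    b           ≈⟨ residue-≡ₚ b ⟨
    + (b %ℕ p)  ∎)

  %ℕ≡⇒≡ₚ : ∀ {a b} → a %ℕ p ≡ b %ℕ p → a ≡ₚ b
  %ℕ≡⇒≡ₚ {a} {b} eq = begin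
    a           ≈⟨ residue-≡ₚ a ⟨
    + (a %ℕ p)  ≡⟨ cong +_ eq ⟩
    + (b %ℕ p)  ≈⟨ residue-≡ₚ b ⟩
    b           ∎

  legendre-cong : ∀ {a b} → a ≡ₚ b → legendre p a ≡ legendre p b
  legendre-cong {a} {b} a≡b = ≡.trans (legendre-residueSymbol p a)
    (≡.trans (cong (residueSymbol p) (≡ₚ⇒%ℕ≡ a≡b)) (≡.sym (legendre-residueSymbol p b)))

  IsSquare : ℤ → Set
  IsSquare a = ∃[ x ] x ℤ.* x ≡ₚ a

  data LegendreView (a : ℤ) : ℤ → Set where
    divisible  : a ≡ₚ 0ℤ → LegendreView a 0ℤ
    residue    : a ≢ₚ 0ℤ → IsSquare a → LegendreView a 1ℤ
    nonresidue : a ≢ₚ 0ℤ → ¬ IsSquare a → LegendreView a -1ℤ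

  private
    0%p≡0 : 0ℤ %ℕ p ≡ 0
    0%p≡0 = ℕ/.m*n%n≡0 0 p

    residue≢0 : ∀ {a} → a ≢ₚ 0ℤ → a %ℕ p ≢ 0
    residue≢0 a≢0 r≡0 = a≢0 (%ℕ≡⇒≡ₚ (≡.trans r≡0 (≡.sym 0%p≡0)))

    nonzero : ∀ {a} → (a %ℕ p ≡ᵇ 0) ≡ false → a ≢ₚ 0ℤ
    nonzero r≢ᵇ0 a≡0 = ≡.subst T r≢ᵇ0 (ℕₚ.≡⇒≡ᵇ _ 0 (≡.trans (≡ₚ⇒%ℕ≡ a≡0) 0%p≡0))

    squareResidue? : ℕ → Bool
    squareResidue? r = any (λ x → (x ℕ.* x) ℕ.% p ≡ᵇ r) (upTo p)

    view-by-tests : ∀ a {z s} → (a %ℕ p ≡ᵇ 0) ≡ z → squareResidue? (a %ℕ p) ≡ s →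
                    LegendreView a (if z then 0ℤ else if s then 1ℤ else -1ℤ)
    view-by-tests a {true}          r≡ᵇ0 _     =
      divisible (%ℕ≡⇒≡ₚ (≡.trans (ℕₚ.≡ᵇ⇒≡ _ 0 (≡.subst T (≡.sym r≡ᵇ0) _)) (≡.sym 0%p≡0)))
    view-by-tests a {false} {true}  r≢ᵇ0 found =
      let x , x²≡r = satisfied (any⁻ _ (upTo p) (≡.subst T (≡.sym found) _))
      in residue (nonzero r≢ᵇ0) (+ x , ≡ₚ-trans (≡ₚ-reflexive (≡.sym (ℤₚ.pos-* x x))) (%ℕ≡⇒≡ₚ (ℕₚ.≡ᵇ⇒≡ _ _ x²≡r)))
    view-by-tests a {false} {false} r≢ᵇ0 found = nonresidue (nonzero r≢ᵇ0) non-square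
      where
      non-square : ¬ IsSquare a
      non-square (y , y²≡a) = ≡.subst T found (any⁺ _ (Any.map (λ { ≡.refl → x²≡r }) (∈-upTo⁺ (n%ℕd<d y p))))
        where
        x = y %ℕ p
        x²≡r : T ((x ℕ.* x) ℕ.% p ≡ᵇ a %ℕ p)
        x²≡r = ℕₚ.≡⇒≡ᵇ _ _ (≡ₚ⇒%ℕ≡ (begin
          + (x ℕ.* x)       ≡⟨ ℤₚ.pos-* x x ⟩
          + x ℤ.* + x       ≈⟨ *-congₚ (residue-≡ₚ y) (residue-≡ₚ y) ⟩
          y ℤ.* y           ≈⟨ y²≡a ⟩
          a                 ∎))

  legendre-view : ∀ a → LegendreView a (legendre p a)
  legendre-view a = ≡.subst (LegendreView a) (≡.sym (legendre-residueSymbol p a)) (view-by-tests a ≡.refl ≡.refl)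

  euclid : ∀ {a b} → a ℤ.* b ≡ₚ 0ℤ → a ≡ₚ 0ℤ ⊎ b ≡ₚ 0ℤ
  euclid {a} {b} ab≡0
    with euclidsLemma ℤ.∣ a ∣ ℤ.∣ b ∣ p-prime (≡.subst (p ℕ∣.∣_) (ℤₚ.abs-* a b) (ℤ∣.∣⇒∣ᵤ (≡ₚ0⇒∣ ab≡0)))
  ... | inj₁ p∣a = inj₁ (∣⇒≡ₚ0 (ℤ∣.∣ᵤ⇒∣ p∣a))
  ... | inj₂ p∣b = inj₂ (∣⇒≡ₚ0 (ℤ∣.∣ᵤ⇒∣ p∣b))

  *-nonzero : ∀ {a b} → a ≢ₚ 0ℤ → b ≢ₚ 0ℤ → a ℤ.* b ≢ₚ 0ℤ
  *-nonzero a≢0 b≢0 ab≡0 with euclid ab≡0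
  ... | inj₁ a≡0 = a≢0 a≡0
  ... | inj₂ b≡0 = b≢0 b≡0

  *-cancelʳₚ : ∀ {a b c} → c ≢ₚ 0ℤ → a ℤ.* c ≡ₚ b ℤ.* c → a ≡ₚ b
  *-cancelʳₚ {a} {b} {c} c≢0 (congruent d) =
    [ (λ a-b≡0 → congruent (≡ₚ0⇒∣ a-b≡0)) , (λ c≡0 → contradiction c≡0 c≢0) ]′
      (euclid {a ℤ.- b} {c} (∣⇒≡ₚ0 (∣-resp-≡ (identity a b c) d)))
    where identity : ∀ a b c → (a ℤ.- b) ℤ.* c ≡ a ℤ.* c ℤ.- b ℤ.* c
          identity = solve-∀

  positive-below-p : ∀ {n} → 0 ℕ.< n → n ℕ.< p → + n ≢ₚ 0ℤ
  positive-below-p {suc n} _ n<p n≡0 = contradiction n<p (ℕₚ.≤⇒≯ (ℕ∣.∣⇒≤ (ℤ∣.∣⇒∣ᵤ (≡ₚ0⇒∣ n≡0))))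

  1≢ₚ0 : 1ℤ ≢ₚ 0ℤ
  1≢ₚ0 = positive-below-p (ℕ.s≤s ℕ.z≤n) (ℕ.nonTrivial⇒n>1 p {{prime⇒nonTrivial p-prime}})

  ±-root : ∀ {x y} → x ℤ.* x ≡ₚ y ℤ.* y → x ≡ₚ y ⊎ x ≡ₚ ℤ.- y
  ±-root {x} {y} (congruent d) =
    Sum.map (λ x-y≡0 → congruent (≡ₚ0⇒∣ x-y≡0))
            (λ x+y≡0 → congruent (∣-resp-≡ (identity₂ x y) (≡ₚ0⇒∣ x+y≡0)))
            (euclid {x ℤ.- y} {x ℤ.+ y} (∣⇒≡ₚ0 (∣-resp-≡ (identity₁ x y) d)))
    where
    identity₁ : ∀ x y → (x ℤ.- y) ℤ.* (x ℤ.+ y) ≡ x ℤ.* x ℤ.- y ℤ.* y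
    identity₁ = solve-∀
    identity₂ : ∀ x y → x ℤ.- ℤ.- y ≡ x ℤ.+ y
    identity₂ = solve-∀

  private
    bézout-coefficient : ∀ {r} → Bézout.Lemma p r → ℤ
    bézout-coefficient (Bézout.result _ _ (Bézout.+- _ y _)) = ℤ.- + y
    bézout-coefficient (Bézout.result _ _ (Bézout.-+ _ y _)) = + y

    bézout-coefficient-inverts : ∀ {r} → Coprime p r → (l : Bézout.Lemma p r) → + r ℤ.* bézout-coefficient l ≡ₚ 1ℤ
    bézout-coefficient-inverts {r} p⊥r (Bézout.result d g (Bézout.+- x y eq)) = begin
      + r ℤ.* ℤ.- + y                      ≡⟨ identity (+ r) (+ y) ⟩
      1ℤ ℤ.- (1ℤ ℤ.+ + y ℤ.* + r)          ≡⟨ cong (ℤ._-_ 1ℤ) (ℕ-identity⇒ℤ 1 y r x p 1+yr≡xp) ⟩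
      1ℤ ℤ.- + x ℤ.* + p                   ≈⟨ +-congₚ (≡ₚ-refl {1ℤ}) (-‿congₚ (multiple≡ₚ0 (+ x))) ⟩
      1ℤ                                   ∎
      where
      1+yr≡xp = ≡.subst (λ d → d ℕ.+ y ℕ.* r ≡ x ℕ.* p) (GCD.unique g (coprime⇒GCD≡1 p⊥r)) eq
      identity : ∀ r y → r ℤ.* ℤ.- y ≡ 1ℤ ℤ.- (1ℤ ℤ.+ y ℤ.* r)
      identity = solve-∀
    bézout-coefficient-inverts {r} p⊥r (Bézout.result d g (Bézout.-+ x y eq)) = begin
      + r ℤ.* + y                ≡⟨ ℤₚ.*-comm (+ r) (+ y) ⟩
      + y ℤ.* + r                ≡⟨ ℕ-identity⇒ℤ 1 x p y r 1+xp≡yr ⟨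
      1ℤ ℤ.+ + x ℤ.* + p         ≈⟨ +-congₚ (≡ₚ-refl {1ℤ}) (multiple≡ₚ0 (+ x)) ⟩
      1ℤ                         ∎
      where 1+xp≡yr = ≡.subst (λ d → d ℕ.+ x ℕ.* p ≡ y ℕ.* r) (GCD.unique g (coprime⇒GCD≡1 p⊥r)) eq


  inverse : ℤ → ℤ
  inverse a = bézout-coefficient (Bézout.lemma p (a %ℕ p))

  inverse-spec : ∀ {a} → a ≢ₚ 0ℤ → a ℤ.* inverse a ≡ₚ 1ℤ
  inverse-spec {a} a≢0 = begin
    a ℤ.* inverse a            ≈⟨ *-congₚ (residue-≡ₚ a) (≡ₚ-refl {inverse a}) ⟨
    + (a %ℕ p) ℤ.* inverse a   ≈⟨ bézout-coefficient-inverts p⊥r (Bézout.lemma p (a %ℕ p)) ⟩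
    1ℤ                         ∎
    where p⊥r = prime⇒coprime p-prime {{ℕ.≢-nonZero (residue≢0 a≢0)}} (n%ℕd<d a p)

  incongruent-length : ∀ {xs} → AllPairs _≢ₚ_ xs → length xs ℕ.≤ p
  incongruent-length {xs} distinct = ℕₚ.≮⇒≥ λ p<length →
    let i , j , i<j , same-residue = Finₚ.pigeonhole p<length residueOf
    in allPairs-lookup distinct i<j (%ℕ≡⇒≡ₚ (≡.trans (≡.sym (Finₚ.toℕ-fromℕ< _))
                                             (≡.trans (cong toℕ same-residue) (Finₚ.toℕ-fromℕ< _))))
    where
    residueOf : Fin (length xs) → Fin p
    residueOf i = Fin.fromℕ< (n%ℕd<d (lookup xs i) p)

  square-* : ∀ {a b} → IsSquare a → IsSquare b → IsSquare (a ℤ.* b)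
  square-* {a} {b} (x , x²≡a) (y , y²≡b) = x ℤ.* y , (begin
    (x ℤ.* y) ℤ.* (x ℤ.* y)    ≡⟨ identity x y ⟩
    (x ℤ.* x) ℤ.* (y ℤ.* y)    ≈⟨ *-congₚ x²≡a y²≡b ⟩
    a ℤ.* b                    ∎)
    where identity : ∀ x y → (x ℤ.* y) ℤ.* (x ℤ.* y) ≡ (x ℤ.* x) ℤ.* (y ℤ.* y)
          identity = solve-∀

  square-cancel : ∀ {w a} → w ≢ₚ 0ℤ → IsSquare (w ℤ.* w ℤ.* a) → IsSquare a
  square-cancel {w} {a} w≢0 (x , x²≡w²a) = w⁻¹ ℤ.* x , (begin
    (w⁻¹ ℤ.* x) ℤ.* (w⁻¹ ℤ.* x)            ≡⟨ identity w⁻¹ x ⟩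
    (w⁻¹ ℤ.* w⁻¹) ℤ.* (x ℤ.* x)            ≈⟨ *-congₚ (≡ₚ-refl {w⁻¹ ℤ.* w⁻¹}) x²≡w²a ⟩
    (w⁻¹ ℤ.* w⁻¹) ℤ.* (w ℤ.* w ℤ.* a)      ≡⟨ identity′ w w⁻¹ a ⟩
    (w ℤ.* w⁻¹) ℤ.* (w ℤ.* w⁻¹) ℤ.* a      ≈⟨ *-congₚ (*-congₚ (inverse-spec w≢0) (inverse-spec w≢0)) (≡ₚ-refl {a}) ⟩
    1ℤ ℤ.* 1ℤ ℤ.* a                        ≡⟨ ℤₚ.*-identityˡ a ⟩
    a                                      ∎)
    where
    w⁻¹ = inverse w
    identity : ∀ v x → (v ℤ.* x) ℤ.* (v ℤ.* x) ≡ (v ℤ.* v) ℤ.* (x ℤ.* x)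
    identity = solve-∀
    identity′ : ∀ w v a → (v ℤ.* v) ℤ.* (w ℤ.* w ℤ.* a) ≡ (w ℤ.* v) ℤ.* (w ℤ.* v) ℤ.* a
    identity′ = solve-∀

  square? : ∀ a → Dec (IsSquare a)
  square? a with legendre p a | legendre-view a
  ... | _ | divisible a≡0    = yes (0ℤ , ≡ₚ-sym a≡0)
  ... | _ | residue _ □a     = yes □a
  ... | _ | nonresidue _ ¬□a = no ¬□a

  legendre-≡ : ∀ {a b} → (a ≡ₚ 0ℤ ⇔ b ≡ₚ 0ℤ) → (IsSquare a ⇔ IsSquare b) → legendre p a ≡ legendre p b
  legendre-≡ {a} {b} zero⇔ square⇔ with legendre p a | legendre-view a | legendre p b | legendre-view b
  ... | _ | divisible _      | _ | divisible _      = ≡.refl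
  ... | _ | residue _ _      | _ | residue _ _      = ≡.refl
  ... | _ | nonresidue _ _   | _ | nonresidue _ _   = ≡.refl
  ... | _ | divisible a≡0    | _ | residue b≢0 _    = contradiction (Equivalence.to zero⇔ a≡0) b≢0
  ... | _ | divisible a≡0    | _ | nonresidue b≢0 _ = contradiction (Equivalence.to zero⇔ a≡0) b≢0
  ... | _ | residue a≢0 _    | _ | divisible b≡0    = contradiction (Equivalence.from zero⇔ b≡0) a≢0
  ... | _ | nonresidue a≢0 _ | _ | divisible b≡0    = contradiction (Equivalence.from zero⇔ b≡0) a≢0
  ... | _ | residue _ □a     | _ | nonresidue _ ¬□b = contradiction (Equivalence.to square⇔ □a) ¬□b
  ... | _ | nonresidue _ ¬□a | _ | residue _ □b     = contradiction (Equivalence.from square⇔ □b) ¬□a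

  square-resp : ∀ {a b} → a ≡ₚ b → IsSquare a → IsSquare b
  square-resp a≡b (x , x²≡a) = x , ≡ₚ-trans x²≡a a≡b

  private
    zero-transfer : ∀ j {u} v → u ≢ₚ 0ℤ → j ℤ.* u ≡ₚ 0ℤ → j ℤ.* v ≡ₚ 0ℤ
    zero-transfer j {u} v u≢0 ju≡0 =
      [ (λ j≡0 → ≡ₚ-trans (*-congₚ j≡0 (≡ₚ-refl {v})) (≡ₚ-reflexive (ℤₚ.*-zeroˡ v)))
      , (λ u≡0 → contradiction u≡0 u≢0)
      ]′ (euclid {j} {u} ju≡0)

    square-transfer : ∀ j {u v} → u ≢ₚ 0ℤ → IsSquare (u ℤ.* v) → IsSquare (j ℤ.* u) → IsSquare (j ℤ.* v)
    square-transfer j {u} {v} u≢0 □uv □ju =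
      square-cancel u≢0 (square-resp (≡ₚ-reflexive (identity j u v)) (square-* □ju □uv))
      where identity : ∀ j u v → (j ℤ.* u) ℤ.* (u ℤ.* v) ≡ u ℤ.* u ℤ.* (j ℤ.* v)
            identity = solve-∀

  legendre-*ˡ-square-class : ∀ {u v} → u ≢ₚ 0ℤ → v ≢ₚ 0ℤ → IsSquare (u ℤ.* v) →
                             ∀ j → legendre p (j ℤ.* u) ≡ legendre p (j ℤ.* v)
  legendre-*ˡ-square-class {u} {v} u≢0 v≢0 □uv j = legendre-≡
    (mk⇔ (zero-transfer j v u≢0) (zero-transfer j u v≢0))
    (mk⇔ (square-transfer j u≢0 □uv) (square-transfer j v≢0 (square-resp (≡ₚ-reflexive (ℤₚ.*-comm u v)) □uv)))

  legendre-values : ∀ a → legendre p a ≡ 0ℤ ⊎ legendre p a ≡ 1ℤ ⊎ legendre p a ≡ -1ℤ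
  legendre-values a with legendre p a | legendre-view a
  ... | _ | divisible _    = inj₁ ≡.refl
  ... | _ | residue _ _    = inj₂ (inj₁ ≡.refl)
  ... | _ | nonresidue _ _ = inj₂ (inj₂ ≡.refl)

  legendre-swap-± : ∀ k k′ → k′ ℤ.* k′ ≡ₚ ℤ.- (k ℤ.* k) → ∀ j →
                    legendre p (j ℤ.* j ℤ.+ k′ ℤ.* k′) ≡ legendre p (j ℤ.* j ℤ.- k ℤ.* k) ×
                    legendre p (j ℤ.* j ℤ.- k′ ℤ.* k′) ≡ legendre p (j ℤ.* j ℤ.+ k ℤ.* k)
  legendre-swap-± k k′ k′²≡-k² j =
    legendre-cong (+-congₚ (≡ₚ-refl {j ℤ.* j}) k′²≡-k²) ,
    legendre-cong (+-congₚ (≡ₚ-refl {j ℤ.* j})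
      (≡ₚ-trans (-‿congₚ k′²≡-k²) (≡ₚ-reflexive (ℤₚ.neg-involutive (k ℤ.* k)))))

  1≢ₚ-n : ∀ {n} → suc n ℕ.< p → 1ℤ ≢ₚ ℤ.- + n
  1≢ₚ-n {n} 1+n<p 1≡-n = positive-below-p (ℕ.s≤s ℕ.z≤n) 1+n<p (begin
    + suc n                 ≡⟨ ℤₚ.pos-+ 1 n ⟩
    1ℤ ℤ.+ + n              ≈⟨ +-congₚ 1≡-n (≡ₚ-refl {+ n}) ⟩
    ℤ.- + n ℤ.+ + n         ≡⟨ ℤₚ.+-inverseˡ (+ n) ⟩
    0ℤ                      ∎)

  module OddPrime (h : ℕ) (p≡2h+1 : p ≡ suc (h ℕ.+ h)) where

    Half : ℕ → Set
    Half z = 1 ℕ.≤ z × z ℕ.≤ h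

    private
      ≤h⇒<p : ∀ {z} → z ℕ.≤ h → z ℕ.< p
      ≤h⇒<p {z} z≤h = ≡.subst (z ℕ.<_) (≡.sym p≡2h+1) (ℕ.s≤s (ℕₚ.≤-trans z≤h (ℕₚ.m≤m+n h h)))

    half-nonzero : ∀ {z} → Half z → + z ≢ₚ 0ℤ
    half-nonzero (1≤z , z≤h) = positive-below-p 1≤z (≤h⇒<p z≤h)

    half-square-injective : ∀ {x y} → Half x → Half y → + x ℤ.* + x ≡ₚ + y ℤ.* + y → x ≡ y
    half-square-injective {x} {y} (1≤x , x≤h) (1≤y , y≤h) x²≡y² =
      [ ≡ₚ-below-p⇒≡ (≤h⇒<p x≤h) (≤h⇒<p y≤h) , (λ x≡-y → contradiction (x+y≡0 x≡-y) x+y≢0) ]′ (±-root x²≡y²)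
      where
      x+y≢0 : + (x ℕ.+ y) ≢ₚ 0ℤ
      x+y≢0 = positive-below-p (ℕₚ.≤-trans 1≤x (ℕₚ.m≤m+n x y))
                (≡.subst (x ℕ.+ y ℕ.<_) (≡.sym p≡2h+1) (ℕ.s≤s (ℕₚ.+-mono-≤ x≤h y≤h)))
      x+y≡0 : + x ≡ₚ ℤ.- + y → + (x ℕ.+ y) ≡ₚ 0ℤ
      x+y≡0 x≡-y = begin
        + (x ℕ.+ y)         ≡⟨ ℤₚ.pos-+ x y ⟩
        + x ℤ.+ + y         ≈⟨ +-congₚ x≡-y (≡ₚ-refl {+ y}) ⟩
        ℤ.- + y ℤ.+ + y     ≡⟨ ℤₚ.+-inverseˡ (+ y) ⟩
        0ℤ                  ∎

    fold : ℤ → ℕ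
    fold t with t %ℕ p ℕ.≤? h
    ... | yes _ = t %ℕ p
    ... | no  _ = p ℕ.∸ t %ℕ p

    fold-half : ∀ {t} → t ≢ₚ 0ℤ → Half (fold t)
    fold-half {t} t≢0 with t %ℕ p ℕ.≤? h
    ... | yes r≤h = ℕₚ.n≢0⇒n>0 (residue≢0 t≢0) , r≤h
    ... | no  r≰h = ℕₚ.m<n⇒0<n∸m (n%ℕd<d t p) ,
                    ℕₚ.≤-trans (ℕₚ.∸-monoʳ-≤ p (ℕₚ.≰⇒> r≰h))
                               (ℕₚ.≤-reflexive (≡.trans (cong (ℕ._∸ suc h) p≡2h+1) (ℕₚ.m+n∸m≡n (suc h) h)))

    fold-± : ∀ t → + fold t ≡ₚ t ⊎ + fold t ≡ₚ ℤ.- t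
    fold-± t with t %ℕ p ℕ.≤? h
    ... | yes _ = inj₁ (residue-≡ₚ t)
    ... | no  _ = inj₂ (begin
      + (p ℕ.∸ t %ℕ p)              ≡⟨ ℤₚ.⊖-≥ (ℕₚ.<⇒≤ (n%ℕd<d t p)) ⟨
      p ℤ.⊖ t %ℕ p                  ≡⟨ ℤₚ.m-n≡m⊖n p (t %ℕ p) ⟨
      + p ℤ.- + (t %ℕ p)            ≈⟨ +-congₚ p≡ₚ0 (-‿congₚ (residue-≡ₚ t)) ⟩
      0ℤ ℤ.- t                      ≡⟨ ℤₚ.+-identityˡ (ℤ.- t) ⟩
      ℤ.- t                         ∎)

    fold-square : ∀ t → + fold t ℤ.* + fold t ≡ₚ t ℤ.* t
    fold-square t with fold-± t
    ... | inj₁ f≡t  = *-congₚ f≡t f≡t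
    ... | inj₂ f≡-t = ≡ₚ-trans (*-congₚ f≡-t f≡-t) (≡ₚ-reflexive (identity t))
      where identity : ∀ t → ℤ.- t ℤ.* ℤ.- t ≡ t ℤ.* t
            identity = solve-∀

    private
      half-index : ∀ {i} → i ℕ.< h → Half (suc i)
      half-index i<h = ℕ.s≤s ℕ.z≤n , i<h

      square : ℕ → ℤ
      square i = + suc i ℤ.* + suc i

      square-nonzero : ∀ {i} → i ℕ.< h → square i ≢ₚ 0ℤ
      square-nonzero i<h = *-nonzero (half-nonzero (half-index i<h)) (half-nonzero (half-index i<h))

    -- If u v were not a square, 0, v, the squares i² and the products u i² (1 ≤ i ≤ h) would be
    -- p + 1 pairwise incongruent integers.
    private
      module Counting {u v} (u≢0 : u ≢ₚ 0ℤ) (¬□u : ¬ IsSquare u) (v≢0 : v ≢ₚ 0ℤ) (¬□v : ¬ IsSquare v)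
                      (¬□uv : ¬ IsSquare (u ℤ.* v)) where
        multiple : ℕ → ℤ
        multiple i = u ℤ.* square i
        squares multiples residues : List ℤ
        squares   = applyUpTo square h
        multiples = applyUpTo multiple h
        residues  = 0ℤ ∷ v ∷ squares ++ multiples

        p<length : p ℕ.< length residues
        p<length = ≡.subst (ℕ._< length residues) (≡.sym p≡2h+1) (ℕₚ.≤-reflexive (cong (suc ∘′ suc) (≡.sym (
          ≡.trans (Listₚ.length-++ squares)
                  (≡.cong₂ ℕ._+_ (Listₚ.length-applyUpTo square h) (Listₚ.length-applyUpTo multiple h))))))

        squares-distinct : ∀ {i j} → i ℕ.< j → j ℕ.< h → square i ≢ₚ square j
        squares-distinct {i} {j} i<j j<h i²≡j² = ℕₚ.<⇒≢ i<j (ℕₚ.suc-injective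
          (half-square-injective (half-index (ℕₚ.<-trans i<j j<h)) (half-index j<h) i²≡j²))

        multiples-distinct : ∀ {i j} → i ℕ.< j → j ℕ.< h → multiple i ≢ₚ multiple j
        multiples-distinct i<j j<h ui²≡uj² = squares-distinct i<j j<h (*-cancelʳₚ u≢0
          (≡ₚ-trans (≡ₚ-reflexive (ℤₚ.*-comm _ u)) (≡ₚ-trans ui²≡uj² (≡ₚ-reflexive (ℤₚ.*-comm u _)))))

        square≢multiple : ∀ i {j} → j ℕ.< h → square i ≢ₚ multiple j
        square≢multiple i {j} j<h x²≡uy² = ¬□u (square-cancel (half-nonzero (half-index j<h)) (+ suc i , (begin
          + suc i ℤ.* + suc i       ≈⟨ x²≡uy² ⟩
          u ℤ.* square j            ≡⟨ ℤₚ.*-comm u (square j) ⟩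
          square j ℤ.* u            ∎)))

        v≢square : ∀ i → v ≢ₚ square i
        v≢square i v≡x² = ¬□v (+ suc i , ≡ₚ-sym v≡x²)

        v≢multiple : ∀ i → v ≢ₚ multiple i
        v≢multiple i v≡uy² = ¬□uv (u ℤ.* + suc i , (begin
          (u ℤ.* + suc i) ℤ.* (u ℤ.* + suc i)   ≡⟨ identity u (+ suc i) ⟩
          u ℤ.* (u ℤ.* square i)                ≈⟨ *-congₚ (≡ₚ-refl {u}) v≡uy² ⟨
          u ℤ.* v                               ∎))
          where identity : ∀ u y → (u ℤ.* y) ℤ.* (u ℤ.* y) ≡ u ℤ.* (u ℤ.* (y ℤ.* y))
                identity = solve-∀

        distinct : AllPairs _≢ₚ_ residues
        distinct =
          (v≢0 ∘′ ≡ₚ-sym ∷ Allₚ.++⁺ (Allₚ.applyUpTo⁺₁ square h (λ i<h → square-nonzero i<h ∘′ ≡ₚ-sym))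
                                   (Allₚ.applyUpTo⁺₁ multiple h (λ i<h → *-nonzero u≢0 (square-nonzero i<h) ∘′ ≡ₚ-sym)))
          ∷ Allₚ.++⁺ (Allₚ.applyUpTo⁺₂ square h v≢square) (Allₚ.applyUpTo⁺₂ multiple h v≢multiple)
          ∷ AllPairsₚ.++⁺ (AllPairsₚ.applyUpTo⁺₁ square h squares-distinct)
                          (AllPairsₚ.applyUpTo⁺₁ multiple h multiples-distinct)
                          (Allₚ.applyUpTo⁺₂ square h (λ i → Allₚ.applyUpTo⁺₁ multiple h (square≢multiple i)))

        too-many-residues : ⊥
        too-many-residues = contradiction (incongruent-length distinct) (ℕₚ.<⇒≱ p<length)

    nonresidue-product : ∀ {u v} → u ≢ₚ 0ℤ → ¬ IsSquare u → v ≢ₚ 0ℤ → ¬ IsSquare v → IsSquare (u ℤ.* v)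
    nonresidue-product u≢0 ¬□u v≢0 ¬□v =
      decidable-stable (square? _) (Counting.too-many-residues u≢0 ¬□u v≢0 ¬□v)

    private
      sq : ℕ → ℤ
      sq n = + n ℤ.* + n

      Reciprocal : ℕ → ℕ → Set
      Reciprocal z x = sq z ℤ.* sq x ≡ₚ 1ℤ

      reciprocal-unique : ∀ {z z′ x} → Half z → Half z′ → Half x →
                          Reciprocal z x → Reciprocal z′ x → z ≡ z′
      reciprocal-unique hz hz′ hx zx≡1 z′x≡1 = half-square-injective hz hz′
        (*-cancelʳₚ (*-nonzero (half-nonzero hx) (half-nonzero hx)) (≡ₚ-trans zx≡1 (≡ₚ-sym z′x≡1)))

      reciprocal-sym : ∀ z x → Reciprocal z x → Reciprocal x z
      reciprocal-sym z x = ≡ₚ-trans (≡ₚ-reflexive (ℤₚ.*-comm (sq x) (sq z)))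

      reciprocal : ℕ → ℕ
      reciprocal x = fold (inverse (+ x))

      module _ {x} (hx : Half x) where
        private
          x⁻¹ = inverse (+ x)
          xx⁻¹≡1 : + x ℤ.* x⁻¹ ≡ₚ 1ℤ
          xx⁻¹≡1 = inverse-spec (half-nonzero hx)

        reciprocal-half : Half (reciprocal x)
        reciprocal-half = fold-half λ x⁻¹≡0 → 1≢ₚ0 (begin
          1ℤ              ≈⟨ xx⁻¹≡1 ⟨
          + x ℤ.* x⁻¹     ≈⟨ *-congₚ (≡ₚ-refl {+ x}) x⁻¹≡0 ⟩
          + x ℤ.* 0ℤ      ≡⟨ ℤₚ.*-zeroʳ (+ x) ⟩
          0ℤ              ∎)

        reciprocal-spec : Reciprocal (reciprocal x) x
        reciprocal-spec = begin
          sq (fold x⁻¹) ℤ.* sq x              ≈⟨ *-congₚ (fold-square x⁻¹) (≡ₚ-refl {sq x}) ⟩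
          (x⁻¹ ℤ.* x⁻¹) ℤ.* (+ x ℤ.* + x)     ≡⟨ identity x⁻¹ (+ x) ⟩
          (+ x ℤ.* x⁻¹) ℤ.* (+ x ℤ.* x⁻¹)     ≈⟨ *-congₚ xx⁻¹≡1 xx⁻¹≡1 ⟩
          1ℤ                                  ∎
          where identity : ∀ y x → (y ℤ.* y) ℤ.* (x ℤ.* x) ≡ (x ℤ.* y) ℤ.* (x ℤ.* y)
                identity = solve-∀

      reciprocal-involutive : ∀ {x} → Half x → reciprocal (reciprocal x) ≡ x
      reciprocal-involutive {x} hx = reciprocal-unique (reciprocal-half (reciprocal-half hx)) hx (reciprocal-half hx)
        (reciprocal-spec (reciprocal-half hx)) (reciprocal-sym (reciprocal x) x (reciprocal-spec hx))

      reciprocal≡1⇒≡1 : ∀ {z x} → Half x → Reciprocal z x → z ≡ 1 → x ≡ 1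
      reciprocal≡1⇒≡1 {x = x} hx@(1≤x , x≤h) zx≡1 ≡.refl = half-square-injective hx (ℕ.s≤s ℕ.z≤n , ℕₚ.≤-trans 1≤x x≤h)
        (≡ₚ-trans (≡ₚ-reflexive (≡.sym (ℤₚ.*-identityˡ (sq x)))) zx≡1)

    -- If −1 were not a square, x ↦ (the representative in [1, h] of ±x⁻¹) would be a fixed-point-free
    -- involution of {2, …, h}, a set of odd size h − 1.
    private
      module ParityArgument {t} (h≡2[1+t] : h ≡ 2 ℕ.* suc t) (¬□-1 : ¬ IsSquare -1ℤ) where
        h≡2+2t : h ≡ 2 ℕ.+ 2 ℕ.* t
        h≡2+2t = ≡.trans h≡2[1+t] (ℕₚ.*-suc 2 t)

        xs : List ℕ
        xs = applyUpTo (2 ℕ.+_) (suc (2 ℕ.* t))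

        ∈xs⁻ : ∀ {x} → x ∈ xs → 2 ℕ.≤ x × x ℕ.≤ h
        ∈xs⁻ x∈ with i , i<n , ≡.refl ← ∈-applyUpTo⁻ (2 ℕ.+_) x∈ =
          ℕₚ.m≤m+n 2 i , ≡.subst (2 ℕ.+ i ℕ.≤_) (≡.sym h≡2+2t) (ℕₚ.+-monoʳ-≤ 2 (ℕₚ.≤-pred i<n))

        ∈xs⁺ : ∀ {x} → 2 ℕ.≤ x → x ℕ.≤ h → x ∈ xs
        ∈xs⁺ {x} 2≤x x≤h = ≡.subst (_∈ xs) (ℕₚ.m+[n∸m]≡n 2≤x)
          (∈-applyUpTo⁺ (2 ℕ.+_) (ℕ.s≤s (ℕₚ.∸-monoˡ-≤ 2 (≡.subst (x ℕ.≤_) h≡2+2t x≤h))))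

        half : ∀ {x} → x ∈ xs → Half x
        half x∈ = let 2≤x , x≤h = ∈xs⁻ x∈ in ℕₚ.≤-trans (ℕ.s≤s ℕ.z≤n) 2≤x , x≤h

        1∉xs : ∀ {x} → x ∈ xs → x ≢ 1
        1∉xs x∈ x≡1 = ℕₚ.<⇒≢ (proj₁ (∈xs⁻ x∈)) (≡.sym x≡1)

        closed : ∀ {x} → x ∈ xs → reciprocal x ∈ xs
        closed x∈ = let 1≤r , r≤h = reciprocal-half (half x∈)
                        r≢1 = 1∉xs x∈ ∘′ reciprocal≡1⇒≡1 (half x∈) (reciprocal-spec (half x∈))
                    in ∈xs⁺ (ℕₚ.≤∧≢⇒< 1≤r (r≢1 ∘′ ≡.sym)) r≤h

        fixed-point-free : ∀ {x} → x ∈ xs → reciprocal x ≢ x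
        fixed-point-free {x} x∈ r≡x =
          [ (λ x²≡1 → 1∉xs x∈ (half-square-injective (half x∈) half-1 x²≡1)) , (λ x²≡-1 → ¬□-1 (+ x , x²≡-1)) ]′
            (±-root {sq x} {1ℤ} (≡.subst (λ r → Reciprocal r x) r≡x (reciprocal-spec (half x∈))))
          where half-1 = ℕ.s≤s ℕ.z≤n , ℕₚ.≤-trans (proj₁ (half x∈)) (proj₂ (half x∈))

        free : FreeInvolution.FreeInvolutionOn ℕ._≟_ reciprocal xs
        free = record
          { closed           = closed
          ; involutive       = reciprocal-involutive ∘′ half
          ; fixed-point-free = fixed-point-free
          }

        parity-clash : ⊥
        parity-clash =
          let k , length≡2k = FreeInvolution.length-even ℕ._≟_ reciprocal
                (Uniqueₚ.applyUpTo⁺₁ (2 ℕ.+_) _ (λ i<j _ → ℕₚ.<⇒≢ i<j ∘′ ℕₚ.+-cancelˡ-≡ 2 _ _)) free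
          in ℕₚ.even≢odd k t (≡.trans (≡.sym length≡2k) (Listₚ.length-applyUpTo (2 ℕ.+_) (suc (2 ℕ.* t))))

    minus-one-square : ∀ t → h ≡ 2 ℕ.* suc t → IsSquare -1ℤ
    minus-one-square t h≡2[1+t] = decidable-stable (square? -1ℤ) (ParityArgument.parity-clash h≡2[1+t])

    legendre-*ˡ-cong : ∀ {u v} → legendre p u ≡ legendre p v → ∀ j → legendre p (j ℤ.* u) ≡ legendre p (j ℤ.* v)
    legendre-*ˡ-cong {u} {v} eq j with legendre p u | legendre-view u | legendre p v | legendre-view v
    ... | _ | divisible u≡0      | _ | divisible v≡0      =
      legendre-cong (*-congₚ (≡ₚ-refl {j}) (≡ₚ-trans u≡0 (≡ₚ-sym v≡0)))
    ... | _ | residue u≢0 □u     | _ | residue v≢0 □v     =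
      legendre-*ˡ-square-class u≢0 v≢0 (square-* □u □v) j
    ... | _ | nonresidue u≢0 ¬□u | _ | nonresidue v≢0 ¬□v =
      legendre-*ˡ-square-class u≢0 v≢0 (nonresidue-product u≢0 ¬□u v≢0 ¬□v) j
    ... | _ | divisible _        | _ | residue _ _        = contradiction eq λ ()
    ... | _ | divisible _        | _ | nonresidue _ _     = contradiction eq λ ()
    ... | _ | residue _ _        | _ | divisible _        = contradiction eq λ ()
    ... | _ | residue _ _        | _ | nonresidue _ _     = contradiction eq λ ()
    ... | _ | nonresidue _ _     | _ | divisible _        = contradiction eq λ ()
    ... | _ | nonresidue _ _     | _ | residue _ _        = contradiction eq λ ()

    rotation : IsSquare -1ℤ → ∀ {k} → k ≢ₚ 0ℤ → ∃[ K ] Half K × + K ℤ.* + K ≡ₚ ℤ.- (k ℤ.* k)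
    rotation (i , i²≡-1) {k} k≢0 = fold (i ℤ.* k) , fold-half ik≢0 , (begin
      + fold (i ℤ.* k) ℤ.* + fold (i ℤ.* k)   ≈⟨ fold-square (i ℤ.* k) ⟩
      (i ℤ.* k) ℤ.* (i ℤ.* k)                 ≡⟨ identity i k ⟩
      (i ℤ.* i) ℤ.* (k ℤ.* k)                 ≈⟨ *-congₚ i²≡-1 (≡ₚ-refl {k ℤ.* k}) ⟩
      -1ℤ ℤ.* (k ℤ.* k)                       ≡⟨ ℤₚ.-1*i≡-i (k ℤ.* k) ⟩
      ℤ.- (k ℤ.* k)                           ∎)
      where
      identity : ∀ i k → (i ℤ.* k) ℤ.* (i ℤ.* k) ≡ (i ℤ.* i) ℤ.* (k ℤ.* k)
      identity = solve-∀
      i≢0 : i ≢ₚ 0ℤ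
      i≢0 i≡0 = 1≢ₚ0 (-‿congₚ (≡ₚ-trans (≡ₚ-sym i²≡-1) (≡ₚ-trans (*-congₚ i≡0 i≡0) (≡ₚ-refl {0ℤ}))))
      ik≢0 = *-nonzero i≢0 k≢0

prime≢2⇒odd : ∀ {p} → Prime p → p ≢ 2 → ∃[ h ] p ≡ suc (h ℕ.+ h)
prime≢2⇒odd {p} p-prime p≢2 = p ℕ./ 2 , (begin
  p                              ≡⟨ ℕ/.m≡m%n+[m/n]*n p 2 ⟩
  p ℕ.% 2 ℕ.+ p ℕ./ 2 ℕ.* 2      ≡⟨ cong (ℕ._+ p ℕ./ 2 ℕ.* 2) p%2≡1 ⟩
  suc (p ℕ./ 2 ℕ.* 2)            ≡⟨ cong suc (ℕₚ.*-comm (p ℕ./ 2) 2) ⟩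
  suc (2 ℕ.* (p ℕ./ 2))          ≡⟨ cong (λ t → suc (p ℕ./ 2 ℕ.+ t)) (ℕₚ.+-identityʳ (p ℕ./ 2)) ⟩
  suc (p ℕ./ 2 ℕ.+ p ℕ./ 2)      ∎)
  where
  open ≡.≡-Reasoning
  p%2≡1 : p ℕ.% 2 ≡ 1
  p%2≡1 with p ℕ.% 2 in p%2≡ | ℕ/.m%n<n p 2
  ... | 0           | _ = [ (λ ()) , (λ 2≡p → contradiction (≡.sym 2≡p) p≢2) ]′
                              (prime⇒irreducible p-prime (ℕ∣.m%n≡0⇒n∣m p 2 p%2≡))
  ... | 1           | _ = ≡.refl
  ... | suc (suc _) | ℕ.s≤s (ℕ.s≤s ())

%4≡1⇒half-even : ∀ {p} → p ℕ.% 4 ≡ 1 → 5 ℕ.< p →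
                 let h = (p ℕ.∸ 1) ℕ./ 2 in ∃[ t ] p ≡ suc (h ℕ.+ h) × h ≡ 2 ℕ.* suc t
%4≡1⇒half-even {p} p%4≡1 5<p with p ℕ./ 4 | ≡.trans (ℕ/.m≡m%n+[m/n]*n p 4) (cong (ℕ._+ p ℕ./ 4 ℕ.* 4) p%4≡1)
... | zero  | p≡1      = contradiction (≡.subst (5 ℕ.<_) p≡1 5<p) λ { (ℕ.s≤s ()) }
... | suc t | p≡1+4q =
  t , ≡.trans p≡1+4q (cong suc (≡.trans (4q≡2q+2q (suc t)) (≡.cong₂ ℕ._+_ (≡.sym h≡2q) (≡.sym h≡2q)))) , h≡2q
  where
  4q≡2q+2q : ∀ q → q ℕ.* 4 ≡ 2 ℕ.* q ℕ.+ 2 ℕ.* q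
  4q≡2q+2q = ℕSolver.solve-∀
  4q≡2q*2 : ∀ q → q ℕ.* 4 ≡ 2 ℕ.* q ℕ.* 2
  4q≡2q*2 = ℕSolver.solve-∀
  h≡2q : (p ℕ.∸ 1) ℕ./ 2 ≡ 2 ℕ.* suc t
  h≡2q = ≡.trans (cong (λ n → (n ℕ.∸ 1) ℕ./ 2) p≡1+4q)
           (≡.trans (cong (ℕ._/ 2) (4q≡2q*2 (suc t))) (ℕ/.m*n/n≡m (2 ℕ.* suc t) 2))

module IntervalMatrices {a ℓ} (R : CommutativeRing a ℓ) where
  open CommutativeRing R hiding (zero)
  open Det R
  open Determinant R

  interval-size : ∀ {m n : ℤ} {k} → m ℤ.+ + k ℤ.≤ n → k ℕ.≤ ℤ.∣ n ℤ.- m ∣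
  interval-size {m} {n} {k} m+k≤n =
    drop-abs (ℤₚ.≤-trans (ℤₚ.≤-reflexive (identity m (+ k))) (ℤₚ.+-monoˡ-≤ (ℤ.- m) m+k≤n))
    where
    identity : ∀ m k → k ≡ m ℤ.+ k ℤ.- m
    identity = solve-∀
    drop-abs : ∀ {x} → + k ℤ.≤ x → k ℕ.≤ ℤ.∣ x ∣
    drop-abs (ℤ.+≤+ k≤x) = k≤x

  private
    offset≤size : ∀ {m n k : ℤ} → m ℤ.≤ k → k ℤ.≤ n → ℤ.∣ m ℤ.- k ∣ ℕ.≤ ℤ.∣ n ℤ.- m ∣
    offset≤size {m} {n} {k} m≤k k≤n = ≡.subst (ℤ.∣ m ℤ.- k ∣ ℕ.≤_) (ℤₚ.∣i-j∣≡∣j-i∣ m n) (ℤₚ.drop‿+≤+ (begin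
      + ℤ.∣ m ℤ.- k ∣   ≡⟨ ℤₚ.∣-∣-≤ m≤k ⟩
      k ℤ.- m           ≤⟨ ℤₚ.+-monoˡ-≤ (ℤ.- m) k≤n ⟩
      n ℤ.- m           ≡⟨ ℤₚ.∣-∣-≤ (ℤₚ.≤-trans m≤k k≤n) ⟨
      + ℤ.∣ m ℤ.- n ∣   ∎))
      where open ℤₚ.≤-Reasoning

  interval-index : ∀ {m n k : ℤ} → m ℤ.≤ k → k ℤ.≤ n → Σ[ i ∈ Fin (suc ℤ.∣ n ℤ.- m ∣) ] m ℤ.+ + toℕ i ≡ k
  interval-index {m} {n} {k} m≤k k≤n = Fin.fromℕ< d<size , (begin
    m ℤ.+ + toℕ (Fin.fromℕ< d<size)   ≡⟨ cong (λ t → m ℤ.+ + t) (Finₚ.toℕ-fromℕ< d<size) ⟩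
    m ℤ.+ + ℤ.∣ m ℤ.- k ∣             ≡⟨ cong (ℤ._+_ m) (ℤₚ.∣-∣-≤ m≤k) ⟩
    m ℤ.+ (k ℤ.- m)                   ≡⟨ identity m k ⟩
    k                                 ∎)
    where
    open ≡.≡-Reasoning
    d<size = ℕ.s≤s (offset≤size m≤k k≤n)
    identity : ∀ m k → m ℤ.+ (k ℤ.- m) ≡ k
    identity = solve-∀

  module _ (χ : ℤ → ℤ) (χ-values : ∀ u → χ u ≡ 0ℤ ⊎ χ u ≡ 1ℤ ⊎ χ u ≡ -1ℤ)
           (χ-*ˡ-cong : ∀ {u v} → χ u ≡ χ v → ∀ j → χ (j ℤ.* u) ≡ χ (j ℤ.* v)) where

    private
      code : ℤ → Fin 3
      code (+ 0) = Fin.zero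
      code (+ 1) = Fin.suc Fin.zero
      code _     = Fin.suc (Fin.suc Fin.zero)

      code-injective : ∀ u v → code (χ u) ≡ code (χ v) → χ u ≡ χ v
      code-injective u v same with χ u | χ-values u | χ v | χ-values v
      ... | _ | inj₁ ≡.refl        | _ | inj₁ ≡.refl        = ≡.refl
      ... | _ | inj₂ (inj₁ ≡.refl) | _ | inj₂ (inj₁ ≡.refl) = ≡.refl
      ... | _ | inj₂ (inj₂ ≡.refl) | _ | inj₂ (inj₂ ≡.refl) = ≡.refl
      ... | _ | inj₁ ≡.refl        | _ | inj₂ (inj₁ ≡.refl) = contradiction same λ ()
      ... | _ | inj₁ ≡.refl        | _ | inj₂ (inj₂ ≡.refl) = contradiction same λ ()
      ... | _ | inj₂ (inj₁ ≡.refl) | _ | inj₁ ≡.refl        = contradiction same λ ()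
      ... | _ | inj₂ (inj₁ ≡.refl) | _ | inj₂ (inj₂ ≡.refl) = contradiction same λ ()
      ... | _ | inj₂ (inj₂ ≡.refl) | _ | inj₁ ≡.refl        = contradiction same λ ()
      ... | _ | inj₂ (inj₂ ≡.refl) | _ | inj₂ (inj₁ ≡.refl) = contradiction same λ ()

    det-character-matrix≈0 : ∀ m n → m ℤ.+ + 3 ℤ.≤ n → ∀ a b c d →
      det _ (intervalMatrix m n (λ j k → a + b * ofℤ (χ j) + c * ofℤ (χ k) + d * ofℤ (χ (j ℤ.* k)))) ≈ 0#
    det-character-matrix≈0 m n m+3≤n a b c d =
      let i , j , i<j , same-code = Finₚ.pigeonhole (ℕ.s≤s (interval-size m+3≤n)) (λ i → code (χ (column i)))
          same = code-injective (column i) (column j) same-code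
      in det-equal-columns M (Finₚ.<⇒≢ i<j) λ r →
           reflexive (≡.cong₂ (λ s t → a + b * ofℤ (χ (column r)) + c * ofℤ s + d * ofℤ t)
                              same (χ-*ˡ-cong same (column r)))
      where
      column : Fin (suc ℤ.∣ n ℤ.- m ∣) → ℤ
      column i = m ℤ.+ + toℕ i
      M = intervalMatrix m n (λ j k → a + b * ofℤ (χ j) + c * ofℤ (χ k) + d * ofℤ (χ (j ℤ.* k)))

  module _ {p} (p-prime : Prime p) {h} (p≡2h+1 : p ≡ suc (h ℕ.+ h)) where
    open Residues p p-prime
    open OddPrime h p≡2h+1
    open import Algebra.Properties.Ring ring using (-‿distribˡ-*)
    import Tactic.RingSolver.Core.AlmostCommutativeRing as ACR
    open import Tactic.RingSolver.NonReflective (ACR.fromCommutativeRing R (λ _ → nothing)) using (solve; _⊜_; _⊕_)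

    quadraticEntry : Carrier → ℤ → ℤ → ℤ → Carrier
    quadraticEntry x δ j k =
      x + ofℤ (legendre p (j ℤ.* j ℤ.+ k ℤ.* k)) + ofℤ δ * ofℤ (legendre p (j ℤ.* j ℤ.- k ℤ.* k))

    private
      ofℤ1*y≈y : ∀ y → ofℤ 1ℤ * y ≈ y
      ofℤ1*y≈y y = trans (*-congʳ (+-identityʳ 1#)) (*-identityˡ y)

      ofℤ-1*y≈-y : ∀ y → ofℤ -1ℤ * y ≈ - y
      ofℤ-1*y≈-y y = trans (sym (-‿distribˡ-* _ y)) (-‿cong (ofℤ1*y≈y y))

    quadraticEntry-rotation-+ : ∀ k k′ → k′ ℤ.* k′ ≡ₚ ℤ.- (k ℤ.* k) → ∀ x j →
                                quadraticEntry x 1ℤ j k′ ≈ quadraticEntry x 1ℤ j k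
    quadraticEntry-rotation-+ k k′ rot x j = begin
      quadraticEntry x 1ℤ j k′
        ≡⟨ ≡.cong₂ (λ s t → x + ofℤ s + ofℤ 1ℤ * ofℤ t) (proj₁ swap) (proj₂ swap) ⟩
      x + B + ofℤ 1ℤ * A    ≈⟨ +-cong (+-congˡ (sym (ofℤ1*y≈y B))) (ofℤ1*y≈y A) ⟩
      x + ofℤ 1ℤ * B + A    ≈⟨ +-assoc x _ A ⟩
      x + (ofℤ 1ℤ * B + A)  ≈⟨ +-congˡ (+-comm _ A) ⟩
      x + (A + ofℤ 1ℤ * B)  ≈⟨ +-assoc x A _ ⟨
      x + A + ofℤ 1ℤ * B    ∎
      where
      open import Relation.Binary.Reasoning.Setoid setoid
      swap = legendre-swap-± k k′ rot j
      A = ofℤ (legendre p (j ℤ.* j ℤ.+ k ℤ.* k))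
      B = ofℤ (legendre p (j ℤ.* j ℤ.- k ℤ.* k))

    quadraticEntry-rotation-− : ∀ k k′ → k′ ℤ.* k′ ≡ₚ ℤ.- (k ℤ.* k) → ∀ x j →
                                quadraticEntry x -1ℤ j k + quadraticEntry x -1ℤ j k′ ≈ x + x
    quadraticEntry-rotation-− k k′ rot x j = begin
      quadraticEntry x -1ℤ j k + quadraticEntry x -1ℤ j k′
        ≡⟨ ≡.cong₂ (λ s t → (x + A + ofℤ -1ℤ * B) + (x + ofℤ s + ofℤ -1ℤ * ofℤ t)) (proj₁ swap) (proj₂ swap) ⟩
      (x + A + ofℤ -1ℤ * B) + (x + B + ofℤ -1ℤ * A)
        ≈⟨ +-cong (+-congˡ (ofℤ-1*y≈-y B)) (+-congˡ (ofℤ-1*y≈-y A)) ⟩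
      (x + A + - B) + (x + B + - A)
        ≈⟨ solve 5 (λ x a b a′ b′ → ((x ⊕ a ⊕ b′) ⊕ (x ⊕ b ⊕ a′)) ⊜ ((x ⊕ x) ⊕ ((a ⊕ a′) ⊕ (b ⊕ b′))))
                   refl x A B (- A) (- B) ⟩
      (x + x) + ((A + - A) + (B + - B))
        ≈⟨ +-congˡ (trans (+-cong (-‿inverseʳ A) (-‿inverseʳ B)) (+-identityʳ 0#)) ⟩
      (x + x) + 0#
        ≈⟨ +-identityʳ _ ⟩
      x + x ∎
      where
      open import Relation.Binary.Reasoning.Setoid setoid
      swap = legendre-swap-± k k′ rot j
      A = ofℤ (legendre p (j ℤ.* j ℤ.+ k ℤ.* k))
      B = ofℤ (legendre p (j ℤ.* j ℤ.- k ℤ.* k))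

    private
      module Columns {t} (h≡2[1+t] : h ≡ 2 ℕ.* suc t) (5<p : 5 ℕ.< p) (m : ℤ) (m≤1 : m ℤ.≤ 1ℤ) where
        size : ℕ
        size = suc ℤ.∣ + h ℤ.- m ∣

        column : ∀ {K} → Half K → Fin size
        column (1≤K , K≤h) = proj₁ (interval-index (ℤₚ.≤-trans m≤1 (ℤ.+≤+ 1≤K)) (ℤ.+≤+ K≤h))

        column-index : ∀ {K} (hK : Half K) → m ℤ.+ + toℕ (column hK) ≡ + K
        column-index (1≤K , K≤h) = proj₂ (interval-index (ℤₚ.≤-trans m≤1 (ℤ.+≤+ 1≤K)) (ℤ.+≤+ K≤h))

        column-injective : ∀ {K K′} (hK : Half K) (hK′ : Half K′) → K ≢ K′ → column hK ≢ column hK′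
        column-injective hK hK′ K≢K′ same = K≢K′ (ℤₚ.+-injective
          (≡.trans (≡.sym (column-index hK)) (≡.trans (cong (λ i → m ℤ.+ + toℕ i) same) (column-index hK′))))

        2≤h : 2 ℕ.≤ h
        2≤h = ≡.subst (2 ℕ.≤_) (≡.sym (≡.trans h≡2[1+t] (ℕₚ.*-suc 2 t))) (ℕₚ.m≤m+n 2 (2 ℕ.* t))

        half-1 : Half 1
        half-1 = ℕₚ.≤-refl , ℕₚ.≤-trans (ℕ.s≤s ℕ.z≤n) 2≤h

        half-2 : Half 2
        half-2 = ℕ.s≤s ℕ.z≤n , 2≤h

        column-entry : ∀ f {K} (hK : Half K) r → intervalMatrix m (+ h) f r (column hK) ≡ f (m ℤ.+ + toℕ r) (+ K)
        column-entry f hK r = cong (f (m ℤ.+ + toℕ r)) (column-index hK)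

        □-1 = minus-one-square t h≡2[1+t]

        2<p : 2 ℕ.< p
        2<p = ℕₚ.<-trans (ℕ.s≤s (ℕ.s≤s (ℕ.s≤s ℕ.z≤n))) 5<p

        rotation-1 = rotation □-1 1≢ₚ0
        rotation-2 = rotation □-1 (positive-below-p (ℕ.s≤s ℕ.z≤n) 2<p)

        K₁ K₂ : ℕ
        K₁ = proj₁ rotation-1
        K₂ = proj₁ rotation-2

        half-K₁ : Half K₁
        half-K₁ = proj₁ (proj₂ rotation-1)

        half-K₂ : Half K₂
        half-K₂ = proj₁ (proj₂ rotation-2)

        K₁²≡-1 : + K₁ ℤ.* + K₁ ≡ₚ -1ℤ
        K₁²≡-1 = proj₂ (proj₂ rotation-1)

        K₂²≡-4 : + K₂ ℤ.* + K₂ ≡ₚ ℤ.- + 4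
        K₂²≡-4 = proj₂ (proj₂ rotation-2)

        K₁≢1 : K₁ ≢ 1
        K₁≢1 K₁≡1 = 1≢ₚ-n 2<p (≡.subst (λ K → + K ℤ.* + K ≡ₚ -1ℤ) K₁≡1 K₁²≡-1)

        K₂≢1 : K₂ ≢ 1
        K₂≢1 K₂≡1 = 1≢ₚ-n 5<p (≡.subst (λ K → + K ℤ.* + K ≡ₚ ℤ.- + 4) K₂≡1 K₂²≡-4)

    det-quadratic≈0 : ∀ t → h ≡ 2 ℕ.* suc t → 5 ℕ.< p → ∀ δ → δ ≡ 1ℤ ⊎ δ ≡ -1ℤ → ∀ m → m ℤ.≤ 1ℤ → ∀ x →
                      det _ (intervalMatrix m (+ h) (quadraticEntry x δ)) ≈ 0#
    det-quadratic≈0 t h≡2[1+t] 5<p _ (inj₁ ≡.refl) m m≤1 x =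
      det-equal-columns M (column-injective half-1 half-K₁ (K₁≢1 ∘′ ≡.sym)) λ r → begin
        M r (column half-1)                    ≡⟨ column-entry E half-1 r ⟩
        E (m ℤ.+ + toℕ r) 1ℤ                   ≈⟨ quadraticEntry-rotation-+ 1ℤ (+ K₁) K₁²≡-1 x (m ℤ.+ + toℕ r) ⟨
        E (m ℤ.+ + toℕ r) (+ K₁)          ≡⟨ column-entry E half-K₁ r ⟨
        M r (column half-K₁)         ∎
      where
      open Columns h≡2[1+t] 5<p m m≤1
      open import Relation.Binary.Reasoning.Setoid setoid
      E = quadraticEntry x 1ℤ
      M = intervalMatrix m (+ h) E
    det-quadratic≈0 t h≡2[1+t] 5<p _ (inj₂ ≡.refl) m m≤1 x =
      det-dependent-columns M (column-injective half-1 half-K₁ (K₁≢1 ∘′ ≡.sym))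
                              (column-injective half-1 half-2 (λ ()))
                              (column-injective half-1 half-K₂ (K₂≢1 ∘′ ≡.sym)) λ r → begin
        M r (column half-1) + M r (column half-K₁)
          ≡⟨ ≡.cong₂ _+_ (column-entry E half-1 r) (column-entry E half-K₁ r) ⟩
        E (m ℤ.+ + toℕ r) 1ℤ + E (m ℤ.+ + toℕ r) (+ K₁)
          ≈⟨ quadraticEntry-rotation-− 1ℤ (+ K₁) K₁²≡-1 x (m ℤ.+ + toℕ r) ⟩
        x + x
          ≈⟨ quadraticEntry-rotation-− (+ 2) (+ K₂) K₂²≡-4 x (m ℤ.+ + toℕ r) ⟨
        E (m ℤ.+ + toℕ r) (+ 2) + E (m ℤ.+ + toℕ r) (+ K₂)
          ≡⟨ ≡.cong₂ _+_ (column-entry E half-2 r) (column-entry E half-K₂ r) ⟨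
        M r (column half-2) + M r (column half-K₂) ∎
      where
      open Columns h≡2[1+t] 5<p m m≤1
      open import Relation.Binary.Reasoning.Setoid setoid
      E = quadraticEntry x -1ℤ
      M = intervalMatrix m (+ h) E

theorem1p1 : ∀ {c ℓ} (R : CommutativeRing c ℓ) →
  let open CommutativeRing R
      open Det R
  in ((p : ℕ) → Prime p → p ≢ 2 → (m n : ℤ) → m ℤ.+ + 3 ℤ.≤ n →
       (a b c d : Carrier) →
       det _ (intervalMatrix m n (λ j k →
         a + b * ofℤ (legendre p j) + c * ofℤ (legendre p k)
           + d * ofℤ (legendre p (j ℤ.* k)))) ≈ 0#)
   × ((p : ℕ) → Prime p → p > 5 → p ℕ.% 4 ≡ 1 →
       (δ : ℤ) → (δ ≡ + 1 ⊎ δ ≡ -[1+ 0 ]) →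
       (m : ℤ) → (m ≡ + 0 ⊎ m ≡ + 1) →
       (x : Carrier) →
       det _ (intervalMatrix m (+ ((p ℕ.∸ 1) ℕ./ 2)) (λ j k →
         x + ofℤ (legendre p (j ℤ.* j ℤ.+ k ℤ.* k))
           + ofℤ δ * ofℤ (legendre p (j ℤ.* j ℤ.- k ℤ.* k)))) ≈ 0#)
theorem1p1 R =
    (λ p p-prime p≢2 →
       let h , p≡2h+1 = prime≢2⇒odd p-prime p≢2
       in det-character-matrix≈0 (legendre p) (Residues.legendre-values p p-prime)
                                 (Residues.OddPrime.legendre-*ˡ-cong p p-prime h p≡2h+1))
  , (λ p p-prime 5<p p%4≡1 δ δ≡±1 m m≡0∨1 →
       let t , p≡2h+1 , h≡2[1+t] = %4≡1⇒half-even p%4≡1 5<p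
       in det-quadratic≈0 p-prime p≡2h+1 t h≡2[1+t] 5<p δ δ≡±1 m
                          ([ (λ { ≡.refl → ℤ.+≤+ ℕ.z≤n }) , (λ { ≡.refl → ℤₚ.≤-refl }) ]′ m≡0∨1))
  where open IntervalMatrices R
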